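{- Let $k\ge1$ and let $W_{n,k}(t)=\sum_{m=0}^{k}w_{n,k,m}t^m$. (a) For all $j\ge1$, $W_{2k+j,k}(t)=\frac{1}{j}\binom{2k+j}{k-1}\operatorname{Nar}^{(j-1)}_{k+j-1}(t)$. (b) $W_{2k,k}(t)=C_k\sum_{m=1}^{k}\binom{k-1}{m-1}\binom{k}{m}t^m$, where $C_k=\frac{1}{k+1}\binom{2k}{k}$ is the $k$th Catalan number. (c) For all $1\le j\le k$, $W_{2k-j,k}(t)=\frac{1}{j}\binom{2k-j}{k-1}\operatorname{Nar}^{(j-1)}_{k-1}(t)$.
   Context: A Dyck path of semilength $n$ is a word in the letters $U,D$ with $n$ copies of each letter such that no prefix contains more $D$'s than $U$'s. A $UD$-factor (resp. $UUD$-factor) is an occurrence of $UD$ (resp. $UUD$) as a consecutive subword. $w_{n,k,m}$ denotes the number of Dyck paths of semilength $n$ with exactly $k$ $UD$-factors and exactly $m$ $UUD$-factors. For $0\le r\le n$, the $r$-generalized Narayana polynomial is $\operatorname{Nar}^{(r)}_n(t)=\sum_{i=0}^{n-r}\frac{r+1}{n+1}\binom{n+1}{i}\binom{n-r-1}{i-1}t^i$, with the convention $\binom{a}{b}=0$ for $b<0$ except $\binom{ -1}{ -1}=1$. -}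

module Defs where

open import Data.Nat using (ℕ; zero; suc; _+_; _*_; _∸_; _≤_; _≤?_)
open import Data.Nat.Combinatorics using (_C_)
open import Data.Integer using (ℤ; +_; -[1+_])
open import Data.Rational using (ℚ; _/_; 0ℚ)
import Data.Rational as Q
open import Data.Bool using (Bool; true; false; _∧_)
open import Data.List using (List; []; _∷_; length; filter; inits; tails; concatMap)
open import Data.List.Relation.Unary.All using (All; all?)
open import Relation.Nullary using (Dec; yes; no)
open import Relation.Nullary.Decidable using (_×-dec_; True)
open import Relation.Binary.PropositionalEquality using (_≡_)
open import Data.Product using (_×_)

data Step : Set where
  U D : Step

words : ℕ → List (List Step)
words zero = [] ∷ []
words (suc ℓ) = concatMap (λ w → (U ∷ w) ∷ (D ∷ w) ∷ []) (words ℓ)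

countU countD : List Step → ℕ
countU [] = 0
countU (U ∷ w) = suc (countU w)
countU (D ∷ w) = countU w
countD [] = 0
countD (U ∷ w) = countD w
countD (D ∷ w) = suc (countD w)

_≟S_ : (a b : Step) → Dec (a ≡ b)
U ≟S U = yes _≡_.refl
U ≟S D = no λ ()
D ≟S U = no λ ()
D ≟S D = yes _≡_.refl

isPrefix : List Step → List Step → Bool
isPrefix [] _ = true
isPrefix (_ ∷ _) [] = false
isPrefix (a ∷ p) (b ∷ w) with a ≟S b
... | yes _ = isPrefix p w
... | no _ = false

-- number of occurrences of the factor p as a consecutive subword of w
-- (= number of suffixes of w starting with p)
countFactor : List Step → List Step → ℕ
countFactor p w = length (filter (λ s → Relation.Nullary.Decidable.Core.T? (isPrefix p s)) (tails w))
  where import Relation.Nullary.Decidable.Core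

IsDyck : ℕ → List Step → Set
IsDyck n w = (countU w ≡ n × countD w ≡ n) × All (λ p → countD p ≤ countU p) (inits w)

isDyck? : (n : ℕ) → (w : List Step) → Dec (IsDyck n w)
isDyck? n w = ((countU w Data.Nat.≟ n) ×-dec (countD w Data.Nat.≟ n))
              ×-dec all? (λ p → countD p ≤? countU p) (inits w)

WP : ℕ → ℕ → ℕ → List Step → Set
WP n k m w = IsDyck n w × (countFactor (U ∷ D ∷ []) w ≡ k × countFactor (U ∷ U ∷ D ∷ []) w ≡ m)

WP? : (n k m : ℕ) → (w : List Step) → Dec (WP n k m w)
WP? n k m w = isDyck? n w ×-dec ((countFactor (U ∷ D ∷ []) w Data.Nat.≟ k)
                                  ×-dec (countFactor (U ∷ U ∷ D ∷ []) w Data.Nat.≟ m))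

wnkm : ℕ → ℕ → ℕ → ℕ
wnkm n k m = length (filter (WP? n k m) (words (n + n)))

ℕ→ℚ : ℕ → ℚ
ℕ→ℚ a = (+ a) / 1

-- coefficient of t^m in W_{n,k}(t) = Σ_{m=0}^{k} w_{n,k,m} t^m
Wcoeff : ℕ → ℕ → ℕ → ℚ
Wcoeff n k m with m ≤? k
... | yes _ = ℕ→ℚ (wnkm n k m)
... | no _ = 0ℚ

-- binomial coefficient with integer arguments and the paper's convention:
-- binom(a,b) = 0 for b < 0, except binom(-1,-1) = 1.
-- (For a < 0 and b ≥ 0 we put 0; this case never arises below.)
binomℤ : ℤ → ℤ → ℕ
binomℤ (+ a) (+ b) = a C b
binomℤ (+ a) -[1+ _ ] = 0
binomℤ -[1+ zero ] -[1+ zero ] = 1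
binomℤ -[1+ _ ] _ = 0

-- coefficient of t^i in Nar^{(r)}_n(t)
--   = (r+1)/(n+1) * C(n+1,i) * binom(n-r-1, i-1)  for 0 ≤ i ≤ n-r, and 0 otherwise
-- (only meaningful for r ≤ n, which is how it is used)
narCoeff : ℕ → ℕ → ℕ → ℚ
narCoeff r n i with i ≤? n ∸ r
... | yes _ = ((+ (suc r)) / (suc n)) Q.* ℕ→ℚ (((suc n) C i) Data.Nat.* binomℤ (Data.Integer._-_ (+ n) (+ (suc r))) (Data.Integer._-_ (+ i) (+ 1)))
... | no _ = 0ℚ

catalanℚ : ℕ → ℚ
catalanℚ k = ((+ ((k + k) C k)) / (suc k))

partBcoeff : ℕ → ℕ → ℚ
partBcoeff k zero = 0ℚ
partBcoeff k (suc m') with suc m' ≤? k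
... | yes _ = catalanℚ k Q.* ℕ→ℚ (((k ∸ 1) C m') * (k C suc m'))
... | no _ = 0ℚ

module Submission where

-- Dyck paths are counted together with all paths from a height h down to 0 that never go below 0:
-- A(h,u,k,m) is the number of those with u up-steps, k peaks and m UUD-factors. Sorting them by how they
-- begin (with D, with UD, or with U followed by U or by nothing) and eliminating the counts per beginning
-- leaves a linear recurrence for A alone which, together with the values at u = 0, determines A. The
-- closed forms A(h,u,k,0) = [u = k]·C(k+h,k) and m·A(h,u,k,m) = C(u−k−1,m−1)·C(k−1,m−1)·(h+1)·C(u+h,k−1)
-- satisfy this recurrence: after Pascal's rule and absorption it is a polynomial identity. At h = 0 this is
-- m·w_{n,k,m} = C(n−k−1,m−1)·C(k−1,m−1)·C(n,k−1), from which the three formulas follow by absorption.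

module Binomial where

  open import Data.Nat using (ℕ; zero; suc; _+_; _*_; _<_; z≤n; s≤s)
  open import Data.Nat.Properties
  open import Data.Nat.Combinatorics using (_C_; nCk+nC[k+1]≡[n+1]C[k+1]; k>n⇒nCk≡0)
  open import Data.Nat.Solver using (module +-*-Solver)
  open import Relation.Binary.PropositionalEquality
  open +-*-Solver
  open ≡-Reasoning

  -- Pascal's recursion, so that binomial coefficients compute by pattern matching.
  binom : ℕ → ℕ → ℕ
  binom n       zero    = 1
  binom zero    (suc k) = 0
  binom (suc n) (suc k) = binom n k + binom n (suc k)

  binom≡C : ∀ n k → binom n k ≡ n C k
  binom≡C n       zero    = refl
  binom≡C zero    (suc k) = sym (k>n⇒nCk≡0 {0} {suc k} (s≤s z≤n))
  binom≡C (suc n) (suc k) =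
    trans (cong₂ _+_ (binom≡C n k) (binom≡C n (suc k))) (nCk+nC[k+1]≡[n+1]C[k+1] n k)

  binom-< : ∀ {n k} → n < k → binom n k ≡ 0
  binom-< {zero}  {suc k} _         = refl
  binom-< {suc n} {suc k} (s≤s n<k) = cong₂ _+_ (binom-< n<k) (binom-< (m≤n⇒m≤1+n n<k))

  binom-diag : ∀ n → binom n n ≡ 1
  binom-diag zero    = refl
  binom-diag (suc n) = cong₂ _+_ (binom-diag n) (binom-< (n<1+n n))

  binom-1 : ∀ n → binom n 1 ≡ n
  binom-1 zero    = refl
  binom-1 (suc n) = cong suc (binom-1 n)

  binom-suc-diag : ∀ n → binom (suc n) n ≡ suc n
  binom-suc-diag zero    = refl
  binom-suc-diag (suc n) = trans (cong₂ _+_ (binom-suc-diag n) (binom-diag (suc n))) (+-comm (suc n) 1)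

  binom-absorption : ∀ n k → suc k * binom (suc n) (suc k) ≡ suc n * binom n k
  binom-absorption zero    zero    = refl
  binom-absorption zero    (suc k) = *-zeroʳ (suc (suc k))
  binom-absorption (suc n) zero    =
    trans (+-identityʳ _) (cong (λ b → suc (suc b)) (trans (binom-1 n) (sym (*-identityʳ n))))
  binom-absorption (suc n) (suc k) = begin
    suc (suc k) * (b₁ + b₂)                   ≡⟨ *-distribˡ-+ (suc (suc k)) b₁ b₂ ⟩
    suc (suc k) * b₁ + suc (suc k) * b₂       ≡⟨ cong₂ (λ x y → b₁ + x + y) (binom-absorption n k) (binom-absorption n (suc k)) ⟩
    b₁ + suc n * binom n k + suc n * binom n (suc k)
      ≡⟨ solve 4 (λ b N x y → b :+ (con 1 :+ N) :* x :+ (con 1 :+ N) :* y := b :+ (con 1 :+ N) :* (x :+ y))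
               refl b₁ n (binom n k) (binom n (suc k)) ⟩
    suc (suc n) * b₁                          ∎
    where
    b₁ = binom (suc n) (suc k)
    b₂ = binom (suc n) (suc (suc k))

  binom-ratio : ∀ k s → suc k * binom (k + s) (suc k) ≡ s * binom (k + s) k
  binom-ratio k s = +-cancelʳ-≡ (suc k * binom n k) _ _ (begin
    suc k * binom n (suc k) + suc k * binom n k
      ≡⟨ trans (+-comm (suc k * binom n (suc k)) _) (sym (*-distribˡ-+ (suc k) (binom n k) _)) ⟩
    suc k * binom (suc n) (suc k)   ≡⟨ binom-absorption n k ⟩
    suc n * binom n k               ≡⟨ cong (λ z → suc z * binom n k) (+-comm k s) ⟩
    suc (s + k) * binom n k
      ≡⟨ solve 3 (λ s k b → (con 1 :+ (s :+ k)) :* b := s :* b :+ (con 1 :+ k) :* b) refl s k (binom n k) ⟩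
    s * binom n k + suc k * binom n k ∎)
    where n = k + s

module ClosedForm where

  open import Data.Nat using (ℕ; zero; suc; pred; _+_; _*_; _∸_; _≤_; _<_; _≤?_; z≤n; s≤s; NonZero)
  open import Data.Nat.Properties
  open import Data.Nat.Solver using (module +-*-Solver)
  open import Data.Product using (∃; _,_)
  open import Data.Sum using (_⊎_; inj₁; inj₂)
  open import Relation.Binary.PropositionalEquality
  open import Relation.Nullary using (yes; no)
  open +-*-Solver
  open ≡-Reasoning
  open Binomial

  Table : Set
  Table = ℕ → ℕ → ℕ → ℕ → ℕ

  at-pred : (ℕ → ℕ) → ℕ → ℕ
  at-pred f zero    = 0
  at-pred f (suc n) = f n

  -- Writing A h u k m as A(h,u,k,m), the recurrence below is
  --   A(h,u+1,k,m) + A(h,u,k,m) + A(h+1,u−1,k−1,m)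
  --     = A(h−1,u+1,k,m) + A(h,u,k−1,m) + A(h+1,u−1,k−1,m−1) + A(h+1,u,k,m),
  -- where terms with a negative index are 0.
  ↓h ↓k ↓uk ↓ukm : Table → Table
  ↓h   A h u k m = at-pred (λ h′ → A h′ (suc u) k m) h
  ↓k   A h u k m = at-pred (λ k′ → A h u k′ m) k
  ↓uk  A h u k m = at-pred (λ u′ → at-pred (λ k′ → A (suc h) u′ k′ m) k) u
  ↓ukm A h u k m = at-pred (↓uk A h u k) m

  RecurrenceAt : Table → ℕ → ℕ → ℕ → ℕ → Set
  RecurrenceAt A h u k m =
    A h (suc u) k m + A h u k m + ↓uk A h u k m
      ≡ ↓h A h u k m + ↓k A h u k m + ↓ukm A h u k m + A (suc h) u k m

  Recurrence : Table → Set
  Recurrence A = ∀ h u k m → RecurrenceAt A h u k m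

  -- The recurrence multiplied by c · c′, where c · A = T at index m and c′ · A = T at index m − 1.
  WeightedRecurrenceAt : Table → ℕ → ℕ → ℕ → ℕ → ℕ → ℕ → Set
  WeightedRecurrenceAt T c c′ h u k m =
    c′ * T h (suc u) k m + c′ * T h u k m + c′ * ↓uk T h u k m
      ≡ c′ * ↓h T h u k m + c′ * ↓k T h u k m + c * ↓ukm T h u k m + c′ * T (suc h) u k m

  δ : ℕ → ℕ → ℕ
  δ zero    zero    = 1
  δ zero    (suc k) = 0
  δ (suc u) zero    = 0
  δ (suc u) (suc k) = δ u k

  δ-diag : ∀ k → δ k k ≡ 1
  δ-diag zero    = refl
  δ-diag (suc k) = δ-diag k

  δ-< : ∀ u k → u < k → δ u k ≡ 0
  δ-< zero    (suc k) _         = refl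
  δ-< (suc u) (suc k) (s≤s u<k) = δ-< u k u<k

  δ-> : ∀ u k → k < u → δ u k ≡ 0
  δ-> (suc u) zero    _         = refl
  δ-> (suc u) (suc k) (s≤s k<u) = δ-> u k k<u

  -- binom (u − K − 2) a, except that it is 0 (rather than binom 0 a) when u < K + 2.
  gapBinom : ℕ → ℕ → ℕ → ℕ
  gapBinom zero    K       a = 0
  gapBinom (suc u) zero    a = at-pred (λ x → binom x a) u
  gapBinom (suc u) (suc K) a = gapBinom u K a

  gapBinom-≤ : ∀ u K a → u ≤ suc K → gapBinom u K a ≡ 0
  gapBinom-≤ zero          K       a _           = refl
  gapBinom-≤ (suc zero)    zero    a _           = refl
  gapBinom-≤ (suc (suc u)) zero    a (s≤s ())
  gapBinom-≤ (suc u)       (suc K) a (s≤s u≤1+K) = gapBinom-≤ u K a u≤1+K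

  gapBinom-+ : ∀ K x a → gapBinom (K + suc (suc x)) K a ≡ binom x a
  gapBinom-+ zero    x a = refl
  gapBinom-+ (suc K) x a = gapBinom-+ K x a

  gapBinom-+suc : ∀ K x a → gapBinom (suc (K + suc (suc x))) K a ≡ binom (suc x) a
  gapBinom-+suc K x a = trans (cong (λ n → gapBinom n K a) (sym (+-suc K (suc (suc x))))) (gapBinom-+ K (suc x) a)

  gapBinom-diag : ∀ K a → gapBinom (suc (suc K)) K a ≡ binom 0 a
  gapBinom-diag zero    a = refl
  gapBinom-diag (suc K) a = gapBinom-diag K a

  gapBinom-cases : ∀ u K → u ≤ K ⊎ u ≡ suc K ⊎ ∃ λ x → u ≡ K + suc (suc x)
  gapBinom-cases zero          K       = inj₁ z≤n
  gapBinom-cases (suc zero)    zero    = inj₂ (inj₁ refl)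
  gapBinom-cases (suc (suc x)) zero    = inj₂ (inj₂ (x , refl))
  gapBinom-cases (suc u)       (suc K) with gapBinom-cases u K
  ... | inj₁ u≤K              = inj₁ (s≤s u≤K)
  ... | inj₂ (inj₁ refl)      = inj₂ (inj₁ refl)
  ... | inj₂ (inj₂ (x , refl)) = inj₂ (inj₂ (x , refl))

  -- Closed h u k m is the closed form of weight m · A(h,u,k,m); for m ≥ 1 the factor m avoids a division,
  -- and closed⁺ h u K a is the case k = K + 1, m = a + 1.
  closed⁺ : ℕ → ℕ → ℕ → ℕ → ℕ
  closed⁺ h u K a = gapBinom u K a * binom K a * (suc h * binom (u + h) K)

  Closed : Table
  Closed h u k zero    = δ u k * binom (k + h) k
  Closed h u k (suc a) = at-pred (λ K → closed⁺ h u K a) k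

  weight : ℕ → ℕ
  weight m = suc (pred m)

  HasClosedForm : Table → ℕ → ℕ → ℕ → ℕ → Set
  HasClosedForm A h u k m = weight m * A h u k m ≡ Closed h u k m

  closed-recurrence₀ : ∀ h u k → RecurrenceAt Closed h u k 0
  closed-recurrence₀ zero    zero    zero = refl
  closed-recurrence₀ (suc h) zero    zero = refl
  closed-recurrence₀ zero    (suc u) zero = refl
  closed-recurrence₀ (suc h) (suc u) zero = refl
  closed-recurrence₀ h u (suc k) = begin
    d₁ * (B₀ + B₁) + d₂ * (B₀ + B₁) + ↓uk Closed h u (suc k) 0 ≡⟨ cong (d₁ * (B₀ + B₁) + d₂ * (B₀ + B₁) +_) (↓uk-value u) ⟩
    d₁ * (B₀ + B₁) + d₂ * (B₀ + B₁) + d₂ * C₀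
      ≡⟨ solve 5 (λ d₁ d₂ B₀ B₁ C₀ → d₁ :* (B₀ :+ B₁) :+ d₂ :* (B₀ :+ B₁) :+ d₂ :* C₀
                   := d₁ :* B₁ :+ d₁ :* B₀ :+ con 0 :+ d₂ :* (C₀ :+ (B₀ :+ B₁))) refl d₁ d₂ B₀ B₁ C₀ ⟩
    d₁ * B₁ + d₁ * B₀ + 0 + d₂ * (C₀ + (B₀ + B₁))
      ≡⟨ cong₂ (λ x y → x + d₁ * B₀ + 0 + d₂ * (C₀ + y)) (↓h-value h) (cong (λ n → binom n (suc k)) (sym (+-suc k h))) ⟩
    ↓h Closed h u (suc k) 0 + ↓k Closed h u (suc k) 0 + 0 + Closed (suc h) u (suc k) 0 ∎
    where
    d₁ = δ u k
    d₂ = δ u (suc k)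
    B₀ = binom (k + h) k
    B₁ = binom (k + h) (suc k)
    C₀ = binom (k + suc h) k
    ↓uk-value : ∀ u → ↓uk Closed h u (suc k) 0 ≡ δ u (suc k) * C₀
    ↓uk-value zero    = refl
    ↓uk-value (suc u) = refl
    ↓h-value : ∀ h → δ u k * binom (k + h) (suc k) ≡ ↓h Closed h u (suc k) 0
    ↓h-value zero    = trans (cong (λ n → δ u k * binom n (suc k)) (+-identityʳ k))
                             (trans (cong (δ u k *_) (binom-< (n<1+n k))) (*-zeroʳ (δ u k)))
    ↓h-value (suc h) = cong (λ n → δ u k * binom n (suc k)) (+-suc k h)

  closed⁺-vanishes : ∀ h u K a → gapBinom u K a ≡ 0 → closed⁺ h u K a ≡ 0
  closed⁺-vanishes h u K a e = cong (λ d → d * binom K a * (suc h * binom (u + h) K)) e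

  closed⁺-unit-gap : ∀ h u K a → gapBinom u K a ≡ 1 → closed⁺ h u K a ≡ binom K a * (suc h * binom (u + h) K)
  closed⁺-unit-gap h u K a e =
    trans (cong (λ d → d * binom K a * (suc h * binom (u + h) K)) e)
          (cong (_* (suc h * binom (u + h) K)) (+-identityʳ (binom K a)))

  closed⁺-suc : ∀ h u K a →
    closed⁺ (suc h) u K a ≡ gapBinom u K a * binom K a * (suc (suc h) * binom (suc (u + h)) K)
  closed⁺-suc h u K a = cong (λ n → gapBinom u K a * binom K a * (suc (suc h) * binom n K)) (+-suc u h)

  ↓h-closed⁺ : ∀ h u K a →
    ↓h Closed h u (suc K) (suc a) ≡ gapBinom (suc u) K a * binom K a * (h * binom (u + h) K)
  ↓h-closed⁺ zero    u K a = sym (*-zeroʳ (gapBinom (suc u) K a * binom K a))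
  ↓h-closed⁺ (suc h) u K a =
    cong (λ n → gapBinom (suc u) K a * binom K a * (suc h * binom n K)) (sym (+-suc u h))

  ↓uk-closed⁺ : ∀ h u J a →
    ↓uk Closed h (suc u) (suc (suc J)) (suc a) ≡ gapBinom u J a * binom J a * (suc (suc h) * binom (suc u + h) J)
  ↓uk-closed⁺ h u J a = cong (λ n → gapBinom u J a * binom J a * (suc (suc h) * binom n J)) (+-suc u h)

  ↓h-closed⁺-vanishes : ∀ h u K a → gapBinom (suc u) K a ≡ 0 → ↓h Closed h u (suc K) (suc a) ≡ 0
  ↓h-closed⁺-vanishes h u K a e =
    trans (↓h-closed⁺ h u K a) (cong (λ d → d * binom K a * (h * binom (u + h) K)) e)

  ↓uk-closed⁺-vanishes : ∀ h u J a → u ≤ suc (suc J) → ↓uk Closed h u (suc (suc J)) (suc a) ≡ 0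
  ↓uk-closed⁺-vanishes h zero    J a _         = refl
  ↓uk-closed⁺-vanishes h (suc u) J a (s≤s u≤) =
    trans (↓uk-closed⁺ h u J a) (cong (λ d → d * binom J a * (suc (suc h) * binom (suc u + h) J)) (gapBinom-≤ u J a u≤))

  vanishing-terms : ∀ {x y z p q r w : ℕ} → x ≡ 0 → y ≡ 0 → z ≡ 0 → p ≡ 0 → q ≡ 0 → r ≡ 0 → w ≡ 0 →
                    x + y + z ≡ p + q + r + w
  vanishing-terms refl refl refl refl refl refl refl = refl

  closed-recurrence₁-low : ∀ h u J → u ≤ suc J → RecurrenceAt Closed h u (suc (suc J)) 1
  closed-recurrence₁-low h u J u≤1+J = vanishing-terms
    (closed⁺-vanishes h (suc u) (suc J) 0 (gapBinom-≤ u J 0 u≤1+J))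
    (closed⁺-vanishes h u (suc J) 0 (gapBinom-≤ u (suc J) 0 (m≤n⇒m≤1+n u≤1+J)))
    (↓uk-closed⁺-vanishes h u J 0 (m≤n⇒m≤1+n u≤1+J))
    (↓h-closed⁺-vanishes h u (suc J) 0 (gapBinom-≤ u J 0 u≤1+J))
    (closed⁺-vanishes h u J 0 (gapBinom-≤ u J 0 u≤1+J))
    (↓ukm-vanishes u u≤1+J)
    (closed⁺-vanishes (suc h) u (suc J) 0 (gapBinom-≤ u (suc J) 0 (m≤n⇒m≤1+n u≤1+J)))
    where
    ↓ukm-vanishes : ∀ u → u ≤ suc J → ↓ukm Closed h u (suc (suc J)) 1 ≡ 0
    ↓ukm-vanishes zero    _         = refl
    ↓ukm-vanishes (suc u) (s≤s u≤J) = cong (_* binom (suc J + suc h) (suc J)) (δ-< u (suc J) (s≤s u≤J))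

  closed-recurrence₁-edge : ∀ h J → RecurrenceAt Closed h (suc (suc J)) (suc (suc J)) 1
  closed-recurrence₁-edge h J = begin
    closed⁺ h (suc u) (suc J) 0 + closed⁺ h u (suc J) 0 + ↓uk Closed h u (suc (suc J)) 1
      ≡⟨ cong₂ _+_ (cong₂ _+_ (closed⁺-unit-gap h (suc u) (suc J) 0 (gapBinom-diag J 0))
                              (closed⁺-vanishes h u (suc J) 0 (gapBinom-≤ (suc J) J 0 ≤-refl)))
                   (↓uk-closed⁺-vanishes h u J 0 ≤-refl) ⟩
    1 * (suc h * (c₀ + c₁)) + 0 + 0
      ≡⟨ solve 3 (λ h c₀ c₁ → con 1 :* ((con 1 :+ h) :* (c₀ :+ c₁)) :+ con 0 :+ con 0
                  := con 1 :* (h :* c₁) :+ con 1 :* ((con 1 :+ h) :* c₀) :+ con 1 :* c₁ :+ con 0) refl h c₀ c₁ ⟩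
    1 * (h * c₁) + 1 * (suc h * c₀) + 1 * c₁ + 0
      ≡⟨ sym (cong₂ _+_ (cong₂ _+_ (cong₂ _+_
           (trans (↓h-closed⁺ h u (suc J) 0) (cong (λ d → d * 1 * (h * c₁)) (gapBinom-diag J 0)))
           (closed⁺-unit-gap h u J 0 (gapBinom-diag J 0)))
           (cong₂ _*_ (δ-diag (suc J)) (cong (λ n → binom n (suc J)) (+-suc (suc J) h))))
           (closed⁺-vanishes (suc h) u (suc J) 0 (gapBinom-≤ (suc J) J 0 ≤-refl))) ⟩
    ↓h Closed h u (suc (suc J)) 1 + ↓k Closed h u (suc (suc J)) 1 + ↓ukm Closed h u (suc (suc J)) 1
      + closed⁺ (suc h) u (suc J) 0 ∎
    where
    u = suc (suc J)
    c₀ = binom (u + h) J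
    c₁ = binom (u + h) (suc J)

  closed-recurrence₁-high : ∀ h J x → RecurrenceAt Closed h (suc J + suc (suc x)) (suc (suc J)) 1
  closed-recurrence₁-high h J x = begin
    closed⁺ h (suc u) (suc J) 0 + closed⁺ h u (suc J) 0 + ↓uk Closed h u (suc (suc J)) 1
      ≡⟨ cong₂ _+_ (cong₂ _+_ (closed⁺-unit-gap h (suc u) (suc J) 0 (gapBinom-+suc J x 0))
                              (closed⁺-unit-gap h u (suc J) 0 (gapBinom-+ J x 0)))
                   (trans (↓uk-closed⁺ h (J + suc (suc x)) J 0)
                          (cong (λ d → d * 1 * (suc (suc h) * c₀)) (gapBinom-+ J x 0))) ⟩
    1 * (suc h * (c₀ + c₁)) + 1 * (suc h * c₁) + 1 * (suc (suc h) * c₀)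
      ≡⟨ solve 3 (λ h c₀ c₁ → con 1 :* ((con 1 :+ h) :* (c₀ :+ c₁)) :+ con 1 :* ((con 1 :+ h) :* c₁) :+ con 1 :* ((con 2 :+ h) :* c₀)
                  := con 1 :* (h :* c₁) :+ con 1 :* ((con 1 :+ h) :* c₀) :+ con 0 :+ con 1 :* ((con 2 :+ h) :* (c₀ :+ c₁))) refl h c₀ c₁ ⟩
    1 * (h * c₁) + 1 * (suc h * c₀) + 0 + 1 * (suc (suc h) * (c₀ + c₁))
      ≡⟨ sym (cong₂ _+_ (cong₂ _+_ (cong₂ _+_
           (trans (↓h-closed⁺ h u (suc J) 0) (cong (λ d → d * 1 * (h * c₁)) (gapBinom-+suc J x 0)))
           (closed⁺-unit-gap h u J 0 (gapBinom-+suc J x 0)))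
           (cong (_* binom (suc J + suc h) (suc J)) (δ-> (J + suc (suc x)) (suc J) 1+J<u)))
           (trans (closed⁺-unit-gap (suc h) u (suc J) 0 (gapBinom-+ J x 0))
                  (cong (λ n → 1 * (suc (suc h) * binom n (suc J))) (+-suc u h)))) ⟩
    ↓h Closed h u (suc (suc J)) 1 + ↓k Closed h u (suc (suc J)) 1 + ↓ukm Closed h u (suc (suc J)) 1
      + closed⁺ (suc h) u (suc J) 0 ∎
    where
    u = suc J + suc (suc x)
    c₀ = binom (u + h) J
    c₁ = binom (u + h) (suc J)
    1+J<u : suc J < J + suc (suc x)
    1+J<u = subst (suc (suc J) ≤_) (sym (+-suc J (suc x))) (s≤s (subst (suc J ≤_) (sym (+-suc J x)) (s≤s (m≤m+n J x))))

  closed-recurrence₁ : ∀ h u K → RecurrenceAt Closed h u (suc K) 1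
  closed-recurrence₁ zero    zero          zero = refl
  closed-recurrence₁ (suc h) zero          zero = refl
  closed-recurrence₁ zero    (suc zero)    zero = refl
  closed-recurrence₁ (suc h) (suc zero)    zero =
    solve 1 (λ h → (con 1 :* con 1) :* ((con 2 :+ h) :* con 1) :+ con 0 :+ con 0
                := (con 1 :* con 1) :* ((con 1 :+ h) :* con 1) :+ con 0 :+ con 1 :* con 1 :+ con 0) refl h
  closed-recurrence₁ zero    (suc (suc x)) zero = refl
  closed-recurrence₁ (suc h) (suc (suc x)) zero =
    solve 1 (λ h → (con 1 :* con 1) :* ((con 2 :+ h) :* con 1) :+ (con 1 :* con 1) :* ((con 2 :+ h) :* con 1) :+ con 0
                := (con 1 :* con 1) :* ((con 1 :+ h) :* con 1) :+ con 0 :+ con 0 :+ (con 1 :* con 1) :* ((con 3 :+ h) :* con 1)) refl h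
  closed-recurrence₁ h u (suc J) with gapBinom-cases u (suc J)
  ... | inj₁ u≤1+J             = closed-recurrence₁-low h u J u≤1+J
  ... | inj₂ (inj₁ refl)       = closed-recurrence₁-edge h J
  ... | inj₂ (inj₂ (x , refl)) = closed-recurrence₁-high h J x

  -- The two sides of the generic case of closed-recurrence₂ once the values of all seven terms are
  -- inserted, defined over any (+, ·, constants) so that they serve both in ℕ and in the solver's syntax.
  Op₈ : Set → Set
  Op₈ A = A → A → A → A → A → A → A → A → A

  module Sides {A : Set} (plus times : A → A → A) (# : ℕ → A) where
    infixl 6 _⊕_
    infixl 7 _⊗_
    _⊕_ _⊗_ : A → A → A
    _⊕_ = plus
    _⊗_ = times

    lhs rhs : Op₈ A
    lhs a h X₀ X₁ J₀ J₁ L₀ L₁ =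
      a ⊗ ((X₀ ⊕ X₁) ⊗ (J₀ ⊕ J₁) ⊗ ((# 1 ⊕ h) ⊗ (L₀ ⊕ L₁))) ⊕ a ⊗ (X₁ ⊗ (J₀ ⊕ J₁) ⊗ ((# 1 ⊕ h) ⊗ L₁))
        ⊕ a ⊗ (X₁ ⊗ J₁ ⊗ ((# 2 ⊕ h) ⊗ L₀))
    rhs a h X₀ X₁ J₀ J₁ L₀ L₁ =
      a ⊗ ((X₀ ⊕ X₁) ⊗ (J₀ ⊕ J₁) ⊗ (h ⊗ L₁)) ⊕ a ⊗ ((X₀ ⊕ X₁) ⊗ J₁ ⊗ ((# 1 ⊕ h) ⊗ L₀))
        ⊕ (# 1 ⊕ a) ⊗ (X₀ ⊗ J₀ ⊗ ((# 2 ⊕ h) ⊗ L₀)) ⊕ a ⊗ (X₁ ⊗ (J₀ ⊕ J₁) ⊗ ((# 2 ⊕ h) ⊗ (L₀ ⊕ L₁)))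

  open Sides {ℕ} _+_ _*_ (λ n → n) using (lhs; rhs)

  lhsₚ rhsₚ : ∀ {n} → Op₈ (Polynomial n)
  lhsₚ = Sides.lhs _:+_ _:*_ con
  rhsₚ = Sides.rhs _:+_ _:*_ con

  -- Clearing the denominators of the three absorption identities turns the claim into a polynomial identity.
  sides-agree′ : ∀ a′ h y z L₀ L₁ → suc (a′ + z) * L₁ ≡ suc (suc (suc ((a′ + y) + h))) * L₀ →
    lhs (suc a′) h (binom (a′ + y) a′) (binom (a′ + y) (suc a′)) (binom (a′ + z) a′) (binom (a′ + z) (suc a′)) L₀ L₁
    ≡ rhs (suc a′) h (binom (a′ + y) a′) (binom (a′ + y) (suc a′)) (binom (a′ + z) a′) (binom (a′ + z) (suc a′)) L₀ L₁
  sides-agree′ a′ h y z L₀ L₁ eL =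
    *-cancelˡ-≡ _ _ (suc (a′ + z)) (*-cancelˡ-≡ _ _ a (*-cancelˡ-≡ _ _ a (begin
      a * (a * (j * lhs a h X₀ X₁ J₀ J₁ L₀ L₁))
        ≡⟨ solve 9 (λ a′ z h X₀ X₁ J₀ J₁ L₀ L₁ → let a = con 1 :+ a′; j = con 1 :+ a′ :+ z in
              a :* (a :* (j :* lhsₚ a h X₀ X₁ J₀ J₁ L₀ L₁)) := lhsₚ a h (a :* X₀) (a :* X₁) (a :* J₀) (a :* J₁) (j :* L₀) (j :* L₁))
             refl a′ z h X₀ X₁ J₀ J₁ L₀ L₁ ⟩
      lhs a h (a * X₀) (a * X₁) (a * J₀) (a * J₁) (j * L₀) (j * L₁)
        ≡⟨ cong₃ (λ p q r → lhs a h (a * X₀) p (a * J₀) q (j * L₀) r) eX eJ eL ⟩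
      lhs a h (a * X₀) (y * X₀) (a * J₀) (z * J₀) (j * L₀) (l * L₀)
        ≡⟨ solve 7 (λ a′ y z h X₀ J₀ L₀ → let a = con 1 :+ a′; j = con 1 :+ a′ :+ z; l = con 3 :+ (a′ :+ y) :+ h in
              lhsₚ a h (a :* X₀) (y :* X₀) (a :* J₀) (z :* J₀) (j :* L₀) (l :* L₀)
              := rhsₚ a h (a :* X₀) (y :* X₀) (a :* J₀) (z :* J₀) (j :* L₀) (l :* L₀))
             refl a′ y z h X₀ J₀ L₀ ⟩
      rhs a h (a * X₀) (y * X₀) (a * J₀) (z * J₀) (j * L₀) (l * L₀)
        ≡⟨ sym (cong₃ (λ p q r → rhs a h (a * X₀) p (a * J₀) q (j * L₀) r) eX eJ eL) ⟩
      rhs a h (a * X₀) (a * X₁) (a * J₀) (a * J₁) (j * L₀) (j * L₁)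
        ≡⟨ solve 9 (λ a′ z h X₀ X₁ J₀ J₁ L₀ L₁ → let a = con 1 :+ a′; j = con 1 :+ a′ :+ z in
              rhsₚ a h (a :* X₀) (a :* X₁) (a :* J₀) (a :* J₁) (j :* L₀) (j :* L₁) := a :* (a :* (j :* rhsₚ a h X₀ X₁ J₀ J₁ L₀ L₁)))
             refl a′ z h X₀ X₁ J₀ J₁ L₀ L₁ ⟩
      a * (a * (j * rhs a h X₀ X₁ J₀ J₁ L₀ L₁)) ∎)))
    where
    a = suc a′
    j = suc (a′ + z)
    l = suc (suc (suc ((a′ + y) + h)))
    X₀ = binom (a′ + y) a′
    X₁ = binom (a′ + y) a
    J₀ = binom (a′ + z) a′
    J₁ = binom (a′ + z) a
    eX : a * X₁ ≡ y * X₀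
    eX = binom-ratio a′ y
    eJ : a * J₁ ≡ z * J₀
    eJ = binom-ratio a′ z
    cong₃ : ∀ {p p′ q q′ r r′ : ℕ} (f : ℕ → ℕ → ℕ → ℕ) → p ≡ p′ → q ≡ q′ → r ≡ r′ → f p q r ≡ f p′ q′ r′
    cong₃ f refl refl refl = refl

  sides-agree : ∀ a′ h J x L₀ L₁ → suc J * L₁ ≡ suc (suc (suc (x + h))) * L₀ →
    lhs (suc a′) h (binom x a′) (binom x (suc a′)) (binom J a′) (binom J (suc a′)) L₀ L₁
    ≡ rhs (suc a′) h (binom x a′) (binom x (suc a′)) (binom J a′) (binom J (suc a′)) L₀ L₁
  sides-agree a′ h J x L₀ L₁ eL with a′ ≤? x | a′ ≤? J
  ... | no a′≰x | _
    rewrite binom-< (≰⇒> a′≰x) | binom-< (m≤n⇒m≤1+n (≰⇒> a′≰x)) =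
    solve 6 (λ a′ h J₀ J₁ L₀ L₁ → lhsₚ (con 1 :+ a′) h (con 0) (con 0) J₀ J₁ L₀ L₁ := rhsₚ (con 1 :+ a′) h (con 0) (con 0) J₀ J₁ L₀ L₁)
            refl a′ h (binom J a′) (binom J (suc a′)) L₀ L₁
  ... | yes _ | no a′≰J
    rewrite binom-< (≰⇒> a′≰J) | binom-< (m≤n⇒m≤1+n (≰⇒> a′≰J)) =
    solve 6 (λ a′ h X₀ X₁ L₀ L₁ → lhsₚ (con 1 :+ a′) h X₀ X₁ (con 0) (con 0) L₀ L₁ := rhsₚ (con 1 :+ a′) h X₀ X₁ (con 0) (con 0) L₀ L₁)
            refl a′ h (binom x a′) (binom x (suc a′)) L₀ L₁
  ... | yes a′≤x | yes a′≤J = split (x ∸ a′) (J ∸ a′) (m+[n∸m]≡n a′≤x) (m+[n∸m]≡n a′≤J) eL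
    where
    split : ∀ y z {x J} → a′ + y ≡ x → a′ + z ≡ J → suc J * L₁ ≡ suc (suc (suc (x + h))) * L₀ →
      lhs (suc a′) h (binom x a′) (binom x (suc a′)) (binom J a′) (binom J (suc a′)) L₀ L₁
      ≡ rhs (suc a′) h (binom x a′) (binom x (suc a′)) (binom J a′) (binom J (suc a′)) L₀ L₁
    split y z refl refl = sides-agree′ a′ h y z L₀ L₁

  vanishing-weighted-terms : ∀ c c′ {x y z p q r w : ℕ} → x ≡ 0 → y ≡ 0 → z ≡ 0 → p ≡ 0 → q ≡ 0 → r ≡ 0 → w ≡ 0 →
    c′ * x + c′ * y + c′ * z ≡ c′ * p + c′ * q + c * r + c′ * w
  vanishing-weighted-terms c c′ refl refl refl refl refl refl refl rewrite *-zeroʳ c | *-zeroʳ c′ = refl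

  closed-recurrence₂-low : ∀ h u J a → u ≤ suc J →
    WeightedRecurrenceAt Closed (suc (suc a)) (suc a) h u (suc (suc J)) (suc (suc a))
  closed-recurrence₂-low h u J a′ u≤1+J = vanishing-weighted-terms (suc a) a
    (closed⁺-vanishes h (suc u) (suc J) a (gapBinom-≤ u J a u≤1+J))
    (closed⁺-vanishes h u (suc J) a (gapBinom-≤ u (suc J) a (m≤n⇒m≤1+n u≤1+J)))
    (↓uk-closed⁺-vanishes h u J a (m≤n⇒m≤1+n u≤1+J))
    (↓h-closed⁺-vanishes h u (suc J) a (gapBinom-≤ u J a u≤1+J))
    (closed⁺-vanishes h u J a (gapBinom-≤ u J a u≤1+J))
    (↓uk-closed⁺-vanishes h u J a′ (m≤n⇒m≤1+n u≤1+J))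
    (closed⁺-vanishes (suc h) u (suc J) a (gapBinom-≤ u (suc J) a (m≤n⇒m≤1+n u≤1+J)))
    where a = suc a′

  closed-recurrence₂-edge : ∀ h J a →
    WeightedRecurrenceAt Closed (suc (suc a)) (suc a) h (suc (suc J)) (suc (suc J)) (suc (suc a))
  closed-recurrence₂-edge h J a′ = vanishing-weighted-terms (suc a) a
    (closed⁺-vanishes h (suc u) (suc J) a (gapBinom-diag J a))
    (closed⁺-vanishes h u (suc J) a (gapBinom-≤ (suc J) J a ≤-refl))
    (closed⁺-vanishes (suc h) (suc J) J a (gapBinom-≤ (suc J) J a ≤-refl))
    (↓h-closed⁺-vanishes h u (suc J) a (gapBinom-diag J a))
    (closed⁺-vanishes h u J a (gapBinom-diag J a))
    (closed⁺-vanishes (suc h) (suc J) J a′ (gapBinom-≤ (suc J) J a′ ≤-refl))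
    (closed⁺-vanishes (suc h) u (suc J) a (gapBinom-≤ (suc J) J a ≤-refl))
    where
    a = suc a′
    u = suc (suc J)

  closed-recurrence₂-high : ∀ h J x a →
    WeightedRecurrenceAt Closed (suc (suc a)) (suc a) h (suc J + suc (suc x)) (suc (suc J)) (suc (suc a))
  closed-recurrence₂-high h J x a′ = begin
    a * closed⁺ h (suc u) (suc J) a + a * closed⁺ h u (suc J) a + a * ↓uk Closed h u (suc (suc J)) (suc a)
      ≡⟨ cong₂ _+_ (cong₂ _+_ (cong (a *_) (with-gap (binom (suc J) a) (suc h * binom (suc L) (suc J)) (gapBinom-+suc J x a)))
                              (cong (a *_) (with-gap (binom (suc J) a) (suc h * binom L (suc J)) (gapBinom-+ J x a))))
                   (cong (a *_) (trans (↓uk-closed⁺ h (J + suc (suc x)) J a) (with-gap (binom J a) (suc (suc h) * L₀) (gapBinom-+ J x a)))) ⟩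
    lhs a h X₀ X₁ J₀ J₁ L₀ L₁
      ≡⟨ sides-agree a′ h J x L₀ L₁ eL ⟩
    rhs a h X₀ X₁ J₀ J₁ L₀ L₁
      ≡⟨ sym (cong₂ _+_ (cong₂ _+_ (cong₂ _+_
           (cong (a *_) (trans (↓h-closed⁺ h u (suc J) a) (with-gap (binom (suc J) a) (h * L₁) (gapBinom-+suc J x a))))
           (cong (a *_) (with-gap (binom J a) (suc h * L₀) (gapBinom-+suc J x a))))
           (cong (suc a *_) (trans (↓uk-closed⁺ h (J + suc (suc x)) J a′) (with-gap (binom J a′) (suc (suc h) * L₀) (gapBinom-+ J x a′)))))
           (cong (a *_) (trans (closed⁺-suc h u (suc J) a) (with-gap (binom (suc J) a) (suc (suc h) * binom (suc L) (suc J)) (gapBinom-+ J x a))))) ⟩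
    a * ↓h Closed h u (suc (suc J)) (suc a) + a * ↓k Closed h u (suc (suc J)) (suc a)
      + suc a * ↓ukm Closed h u (suc (suc J)) (suc a) + a * closed⁺ (suc h) u (suc J) a ∎
    where
    a = suc a′
    u = suc J + suc (suc x)
    L = u + h
    X₀ = binom x a′
    X₁ = binom x a
    J₀ = binom J a′
    J₁ = binom J a
    L₀ = binom L J
    L₁ = binom L (suc J)
    with-gap : ∀ {d d′} B C → d ≡ d′ → d * B * C ≡ d′ * B * C
    with-gap B C e = cong (λ d → d * B * C) e
    eL : suc J * L₁ ≡ suc (suc (suc (x + h))) * L₀
    eL = subst (λ n → suc J * binom n (suc J) ≡ suc (suc (suc (x + h))) * binom n J)
               (solve 3 (λ J x h → J :+ (con 3 :+ (x :+ h)) := (con 1 :+ J :+ (con 2 :+ x)) :+ h) refl J x h)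
               (binom-ratio J (suc (suc (suc (x + h)))))

  closed-recurrence₂ : ∀ h u K a →
    WeightedRecurrenceAt Closed (suc (suc a)) (suc a) h u (suc K) (suc (suc a))
  closed-recurrence₂ h u zero a′ = vanishing-weighted-terms (suc a) a
    (closed⁺-at-0 h (suc u)) (closed⁺-at-0 h u) (↓uk-at-1 u a)
    (trans (↓h-closed⁺ h u 0 a) (cong (_* (h * binom (u + h) 0)) (*-zeroʳ (gapBinom (suc u) 0 a))))
    refl (↓uk-at-1 u a′) (closed⁺-at-0 (suc h) u)
    where
    a = suc a′
    closed⁺-at-0 : ∀ h u → closed⁺ h u 0 a ≡ 0
    closed⁺-at-0 h u = cong (_* (suc h * binom (u + h) 0)) (*-zeroʳ (gapBinom u 0 a))
    ↓uk-at-1 : ∀ u b → ↓uk Closed h u 1 (suc b) ≡ 0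
    ↓uk-at-1 zero    b = refl
    ↓uk-at-1 (suc u) b = refl
  closed-recurrence₂ h u (suc J) a with gapBinom-cases u (suc J)
  ... | inj₁ u≤1+J             = closed-recurrence₂-low h u J a u≤1+J
  ... | inj₂ (inj₁ refl)       = closed-recurrence₂-edge h J a
  ... | inj₂ (inj₂ (x , refl)) = closed-recurrence₂-high h J x a

  scale : ∀ c A h u k m → RecurrenceAt A h u k m → WeightedRecurrenceAt A c c h u k m
  scale c A h u k m e = begin
    c * x + c * y + c * z  ≡⟨ solve 4 (λ c x y z → c :* x :+ c :* y :+ c :* z := c :* (x :+ y :+ z)) refl c x y z ⟩
    c * (x + y + z)        ≡⟨ cong (c *_) e ⟩
    c * (p + q + r + w)
      ≡⟨ solve 5 (λ c p q r w → c :* (p :+ q :+ r :+ w) := c :* p :+ c :* q :+ c :* r :+ c :* w) refl c p q r w ⟩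
    c * p + c * q + c * r + c * w ∎
    where
    x = A h (suc u) k m
    y = A h u k m
    z = ↓uk A h u k m
    p = ↓h A h u k m
    q = ↓k A h u k m
    r = ↓ukm A h u k m
    w = A (suc h) u k m

  closed-recurrence : ∀ h u k m → WeightedRecurrenceAt Closed (weight m) (weight (pred m)) h u k m
  closed-recurrence h u k       zero          = scale 1 Closed h u k 0 (closed-recurrence₀ h u k)
  closed-recurrence h u zero    (suc a)       = vanishing h u
    where
    all-zero : WeightedRecurrenceAt (λ _ _ _ _ → 0) (suc a) (weight a) 0 0 0 0
    all-zero rewrite *-zeroʳ (weight a) | *-zeroʳ (suc a) = refl
    vanishing : ∀ h u → WeightedRecurrenceAt Closed (suc a) (weight a) h u 0 (suc a)
    vanishing zero    zero    = all-zero
    vanishing zero    (suc u) = all-zero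
    vanishing (suc h) zero    = all-zero
    vanishing (suc h) (suc u) = all-zero
  closed-recurrence h u (suc K) (suc zero)    = scale 1 Closed h u (suc K) 1 (closed-recurrence₁ h u K)
  closed-recurrence h u (suc K) (suc (suc a)) = closed-recurrence₂ h u K a

  recurrence-determines-first :
    ∀ c c′ .{{_ : NonZero c′}} {x y z p q r w X Y Z P Q R W : ℕ} →
    x + y + z ≡ p + q + r + w →
    c * y ≡ Y → c * z ≡ Z → c * p ≡ P → c * q ≡ Q → c′ * r ≡ R → c * w ≡ W →
    c′ * X + c′ * Y + c′ * Z ≡ c′ * P + c′ * Q + c * R + c′ * W →
    c * x ≡ X
  recurrence-determines-first c c′ {x} {y} {z} {p} {q} {r} {w} {X} e refl refl refl refl refl refl e′ =
    *-cancelˡ-≡ (c * x) X c′ (+-cancelʳ-≡ (c′ * (c * y)) _ _ (+-cancelʳ-≡ (c′ * (c * z)) _ _ (trans scaled (sym e′))))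
    where
    scaled : c′ * (c * x) + c′ * (c * y) + c′ * (c * z) ≡ c′ * (c * p) + c′ * (c * q) + c * (c′ * r) + c′ * (c * w)
    scaled = begin
      c′ * (c * x) + c′ * (c * y) + c′ * (c * z)
        ≡⟨ solve 5 (λ c c′ x y z → c′ :* (c :* x) :+ c′ :* (c :* y) :+ c′ :* (c :* z) := c′ :* c :* (x :+ y :+ z)) refl c c′ x y z ⟩
      c′ * c * (x + y + z)  ≡⟨ cong (c′ * c *_) e ⟩
      c′ * c * (p + q + r + w)
        ≡⟨ solve 6 (λ c c′ p q r w → c′ :* c :* (p :+ q :+ r :+ w)
                     := c′ :* (c :* p) :+ c′ :* (c :* q) :+ c :* (c′ :* r) :+ c′ :* (c :* w)) refl c c′ p q r w ⟩
      c′ * (c * p) + c′ * (c * q) + c * (c′ * r) + c′ * (c * w) ∎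

  module _ (A : Table) (recurrence : Recurrence A) where

    Solved : ℕ → Set
    Solved u = ∀ h k m → HasClosedForm A h u k m

    ↓k-solved : ∀ {u} → Solved u → ∀ h k m → weight m * ↓k A h u k m ≡ ↓k Closed h u k m
    ↓k-solved solved h zero    m = *-zeroʳ (weight m)
    ↓k-solved solved h (suc k) m = solved h k m

    ↓uk-solved : ∀ {u} → Solved u → ∀ h k m → weight m * ↓uk A h (suc u) k m ≡ ↓uk Closed h (suc u) k m
    ↓uk-solved solved h zero    m = *-zeroʳ (weight m)
    ↓uk-solved solved h (suc k) m = solved (suc h) k m

    -- Besides A(h,u+1,k,m) the recurrence involves A only at u − 1, at u, and at (h − 1, u + 1):
    -- hence induction on h inside the induction on u.
    solved-suc : ∀ {u} → Solved u → (∀ h k m → weight m * ↓uk A h u k m ≡ ↓uk Closed h u k m) → Solved (suc u)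
    solved-suc {u} solved solved-below = go
      where
      go : Solved (suc u)
      ↓h-solved : ∀ h k m → weight m * ↓h A h u k m ≡ ↓h Closed h u k m
      ↓h-solved zero    k m = *-zeroʳ (weight m)
      ↓h-solved (suc h) k m = go h k m
      ↓ukm-solved : ∀ h k m → weight (pred m) * ↓ukm A h u k m ≡ ↓ukm Closed h u k m
      ↓ukm-solved h k zero    = refl
      ↓ukm-solved h k (suc m) = solved-below h k m
      go h k m = recurrence-determines-first (weight m) (weight (pred m)) (recurrence h u k m)
        (solved h k m) (solved-below h k m) (↓h-solved h k m) (↓k-solved solved h k m)
        (↓ukm-solved h k m) (solved (suc h) k m) (closed-recurrence h u k m)

    closed-form : Solved 0 → ∀ u → Solved u
    closed-form solved₀ zero          = solved₀
    closed-form solved₀ (suc zero)    = solved-suc solved₀ (λ h k m → *-zeroʳ (weight m))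
    closed-form solved₀ (suc (suc u)) =
      solved-suc (closed-form solved₀ (suc u)) (↓uk-solved (closed-form solved₀ u))

module Paths where

  open import Defs
  open import Data.Nat using (ℕ; zero; suc; _+_; _*_; _≤_; _≡ᵇ_; z≤n; s≤s)
  open import Data.Nat.Properties using (+-suc; +-identityʳ; +-assoc; suc-injective; +-commutativeSemigroup; *-zeroʳ)
  open import Data.Nat.Solver using (module +-*-Solver)
  open import Data.Bool using (Bool; true; false; _∧_; _∨_; T)
  open import Data.Bool.Properties using (T-∨)
  open import Data.Empty using (⊥; ⊥-elim)
  open import Data.List using (List; []; _∷_; length; filter; concatMap; inits; tails)
  open import Data.List.Relation.Unary.All using (All; []; _∷_)
  import Data.List.Relation.Unary.All as All
  open import Data.List.Relation.Unary.All.Properties using (map⁺; map⁻)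
  open import Data.Product using (_×_; _,_; proj₁; proj₂)
  open import Data.Sum using (_⊎_; inj₁; inj₂; [_,_])
  open import Data.Unit using (tt)
  open import Function.Base using (_∘_)
  open import Function.Bundles using (Equivalence; _⇔_; mk⇔)
  open import Relation.Nullary using (Dec; yes; no; does)
  open import Relation.Nullary.Decidable using (T?)
  open import Relation.Binary.PropositionalEquality hiding ([_])
  open import Algebra.Properties.CommutativeSemigroup +-commutativeSemigroup
    using () renaming (interchange to +-interchange)
  open ClosedForm using (Table; ↓h; ↓k; ↓uk; ↓ukm; Recurrence; HasClosedForm; closed-form)
  open +-*-Solver
  open ≡-Reasoning
  open Equivalence using (to; from)

  indicator : Bool → ℕ
  indicator true  = 1
  indicator false = 0

  count : {A : Set} → (A → Bool) → List A → ℕ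
  count p []       = 0
  count p (x ∷ xs) = indicator (p x) + count p xs

  module _ {A : Set} where

    length-filter≡count : {P : A → Set} (P? : ∀ x → Dec (P x)) (xs : List A) →
                          length (filter P? xs) ≡ count (λ x → does (P? x)) xs
    length-filter≡count P? []       = refl
    length-filter≡count P? (x ∷ xs) with does (P? x)
    ... | true  = cong suc (length-filter≡count P? xs)
    ... | false = length-filter≡count P? xs

    count-cong : {p q : A → Bool} → (∀ x → p x ≡ q x) → ∀ xs → count p xs ≡ count q xs
    count-cong e []       = refl
    count-cong e (x ∷ xs) = cong₂ _+_ (cong indicator (e x)) (count-cong e xs)

    count-none : {p : A → Bool} → (∀ x → p x ≡ false) → ∀ xs → count p xs ≡ 0
    count-none e []       = refl
    count-none e (x ∷ xs) = cong₂ _+_ (cong indicator (e x)) (count-none e xs)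

    indicator-∨ : ∀ a b → (T a → T b → ⊥) → indicator (a ∨ b) ≡ indicator a + indicator b
    indicator-∨ true  true  exclusive = ⊥-elim (exclusive tt tt)
    indicator-∨ true  false _         = refl
    indicator-∨ false b     _         = refl

    count-∨ : {p q : A → Bool} → (∀ x → T (p x) → T (q x) → ⊥) →
              ∀ xs → count (λ x → p x ∨ q x) xs ≡ count p xs + count q xs
    count-∨         exclusive []       = refl
    count-∨ {p} {q} exclusive (x ∷ xs) = trans
      (cong₂ _+_ (indicator-∨ (p x) (q x) (exclusive x)) (count-∨ exclusive xs))
      (+-interchange (indicator (p x)) (indicator (q x)) (count p xs) (count q xs))

  count-words-suc : ∀ p ℓ →
    count p (words (suc ℓ)) ≡ count (λ w → p (U ∷ w)) (words ℓ) + count (λ w → p (D ∷ w)) (words ℓ)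
  count-words-suc p ℓ = go (words ℓ)
    where
    go : ∀ ws → count p (concatMap (λ w → (U ∷ w) ∷ (D ∷ w) ∷ []) ws)
                ≡ count (λ w → p (U ∷ w)) ws + count (λ w → p (D ∷ w)) ws
    go []       = refl
    go (w ∷ ws) = trans (cong (λ n → indicator (p (U ∷ w)) + (indicator (p (D ∷ w)) + n)) (go ws))
      (trans (sym (+-assoc (indicator (p (U ∷ w))) _ _))
             (+-interchange (indicator (p (U ∷ w))) (indicator (p (D ∷ w))) _ _))

  valid : ℕ → List Step → Bool
  valid h       []      = true
  valid h       (U ∷ w) = valid (suc h) w
  valid zero    (D ∷ w) = false
  valid (suc h) (D ∷ w) = valid h w

  valid⇒prefixes : ∀ h w → T (valid h w) → All (λ p → countD p ≤ h + countU p) (inits w)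
  valid⇒prefixes h       []      _ = z≤n ∷ []
  valid⇒prefixes h       (U ∷ w) v = z≤n ∷ map⁺
    (All.map (λ {p} le → subst (countD p ≤_) (sym (+-suc h (countU p))) le) (valid⇒prefixes (suc h) w v))
  valid⇒prefixes (suc h) (D ∷ w) v = z≤n ∷ map⁺ (All.map s≤s (valid⇒prefixes h w v))

  prefixes⇒valid : ∀ h w → All (λ p → countD p ≤ h + countU p) (inits w) → T (valid h w)
  prefixes⇒valid h       []      _        = tt
  prefixes⇒valid h       (U ∷ w) (_ ∷ ps) =
    prefixes⇒valid (suc h) w (All.map (λ {p} le → subst (countD p ≤_) (+-suc h (countU p)) le) (map⁻ ps))
  prefixes⇒valid zero    (D ∷ w) (_ ∷ (() ∷ _))
  prefixes⇒valid (suc h) (D ∷ w) (_ ∷ ps) = prefixes⇒valid h w (All.map (λ { (s≤s le) → le }) (map⁻ ps))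

  startsD startsUD : List Step → ℕ
  startsD (D ∷ _) = 1
  startsD _       = 0
  startsUD (U ∷ D ∷ _) = 1
  startsUD _           = 0

  peaks uuds : List Step → ℕ
  peaks []      = 0
  peaks (D ∷ w) = peaks w
  peaks (U ∷ w) = startsD w + peaks w
  uuds []      = 0
  uuds (D ∷ w) = uuds w
  uuds (U ∷ w) = startsUD w + uuds w

  count-prefix : List Step → List Step → ℕ
  count-prefix p w = count (isPrefix p) (tails w)

  countFactor≡count-prefix : ∀ p w → countFactor p w ≡ count-prefix p w
  countFactor≡count-prefix p w =
    trans (length-filter≡count _ (tails w)) (count-cong (λ s → does-T? (isPrefix p s)) (tails w))
    where
    does-T? : ∀ b → does (T? b) ≡ b
    does-T? true  = refl
    does-T? false = refl

  count-prefix-UD : ∀ w → count-prefix (U ∷ D ∷ []) w ≡ peaks w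
  count-prefix-UD []          = refl
  count-prefix-UD (D ∷ w)     = count-prefix-UD w
  count-prefix-UD (U ∷ [])    = refl
  count-prefix-UD (U ∷ D ∷ w) = cong suc (count-prefix-UD (D ∷ w))
  count-prefix-UD (U ∷ U ∷ w) = count-prefix-UD (U ∷ w)

  count-prefix-UUD : ∀ w → count-prefix (U ∷ U ∷ D ∷ []) w ≡ uuds w
  count-prefix-UUD []              = refl
  count-prefix-UUD (D ∷ w)         = count-prefix-UUD w
  count-prefix-UUD (U ∷ [])        = refl
  count-prefix-UUD (U ∷ D ∷ w)     = count-prefix-UUD (D ∷ w)
  count-prefix-UUD (U ∷ U ∷ [])    = refl
  count-prefix-UUD (U ∷ U ∷ D ∷ w) = cong suc (count-prefix-UUD (U ∷ D ∷ w))
  count-prefix-UUD (U ∷ U ∷ U ∷ w) = count-prefix-UUD (U ∷ U ∷ w)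

  IsPath : ℕ → ℕ → ℕ → ℕ → List Step → Set
  IsPath h u k m w = T (valid h w) × countU w ≡ u × countD w ≡ u + h × peaks w ≡ k × uuds w ≡ m

  WP⇔IsPath : ∀ n k m w → WP n k m w ⇔ IsPath 0 n k m w
  WP⇔IsPath n k m w = mk⇔
    (λ (((eu , ed) , ps) , ek , em) → prefixes⇒valid 0 w ps , eu , trans ed (sym (+-identityʳ n)) ,
       trans (sym (UD-factors w)) ek , trans (sym (UUD-factors w)) em)
    (λ (v , eu , ed , ek , em) → ((eu , trans ed (+-identityʳ n)) , valid⇒prefixes 0 w v) ,
       trans (UD-factors w) ek , trans (UUD-factors w) em)
    where
    UD-factors : ∀ w → countFactor (U ∷ D ∷ []) w ≡ peaks w
    UD-factors w = trans (countFactor≡count-prefix (U ∷ D ∷ []) w) (count-prefix-UD w)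
    UUD-factors : ∀ w → countFactor (U ∷ U ∷ D ∷ []) w ≡ uuds w
    UUD-factors w = trans (countFactor≡count-prefix (U ∷ U ∷ D ∷ []) w) (count-prefix-UUD w)

  -- The kind of a word is read off its first steps; UUₖ means an up-step followed by an up-step or by nothing.
  data Kind : Set where
    εₖ Dₖ UDₖ UUₖ : Kind

  kind : List Step → Kind
  kind []          = εₖ
  kind (D ∷ _)     = Dₖ
  kind (U ∷ D ∷ _) = UDₖ
  kind (U ∷ _)     = UUₖ

  U-then : Kind → Kind
  U-then Dₖ = UDₖ
  U-then _  = UUₖ

  isDₖ isUDₖ : Kind → ℕ
  isDₖ Dₖ = 1
  isDₖ _  = 0
  isUDₖ UDₖ = 1
  isUDₖ _   = 0

  kind-U∷ : ∀ w → kind (U ∷ w) ≡ U-then (kind w)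
  kind-U∷ []          = refl
  kind-U∷ (D ∷ _)     = refl
  kind-U∷ (U ∷ [])    = refl
  kind-U∷ (U ∷ D ∷ _) = refl
  kind-U∷ (U ∷ U ∷ _) = refl

  startsD≡isDₖ : ∀ w → startsD w ≡ isDₖ (kind w)
  startsD≡isDₖ []          = refl
  startsD≡isDₖ (D ∷ _)     = refl
  startsD≡isDₖ (U ∷ [])    = refl
  startsD≡isDₖ (U ∷ D ∷ _) = refl
  startsD≡isDₖ (U ∷ U ∷ _) = refl

  startsUD≡isUDₖ : ∀ w → startsUD w ≡ isUDₖ (kind w)
  startsUD≡isUDₖ []          = refl
  startsUD≡isUDₖ (D ∷ _)     = refl
  startsUD≡isUDₖ (U ∷ [])    = refl
  startsUD≡isUDₖ (U ∷ D ∷ _) = refl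
  startsUD≡isUDₖ (U ∷ U ∷ _) = refl

  IsPath-D∷ : ∀ {h u k m} w → IsPath h u k m w → IsPath (suc h) u k m (D ∷ w)
  IsPath-D∷ {h} {u} w (v , eu , ed , ek , em) = v , eu , trans (cong suc ed) (sym (+-suc u h)) , ek , em

  IsPath-U∷ : ∀ {h u k m k′ m′} c w → kind w ≡ c → IsPath (suc h) u k′ m′ w →
              isDₖ c + k′ ≡ k → isUDₖ c + m′ ≡ m → IsPath h (suc u) k m (U ∷ w) × kind (U ∷ w) ≡ U-then c
  IsPath-U∷ {h} {u} _ w refl (v , eu , ed , ek , em) refl refl =
    (v , cong suc eu , trans ed (+-suc u h) , cong₂ _+_ (startsD≡isDₖ w) ek , cong₂ _+_ (startsUD≡isUDₖ w) em) ,
    kind-U∷ w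

  -- accepts h u k m c w: IsPath h u k m w and kind w ≡ c, computed by recursion on w so that
  -- splitting a count of accepted words by their first step is definitional.
  mutual
    accepts : ℕ → ℕ → ℕ → ℕ → Kind → List Step → Bool
    accepts h       u       k       m       εₖ  []      = (h ≡ᵇ 0) ∧ (u ≡ᵇ 0) ∧ (k ≡ᵇ 0) ∧ (m ≡ᵇ 0)
    accepts h       u       k       m       Dₖ  []      = false
    accepts h       u       k       m       UDₖ []      = false
    accepts h       u       k       m       UUₖ []      = false
    accepts h       u       k       m       εₖ  (_ ∷ _) = false
    accepts h       u       k       m       Dₖ  (U ∷ w) = false
    accepts zero    u       k       m       Dₖ  (D ∷ w) = false
    accepts (suc h) u       k       m       Dₖ  (D ∷ w) = accepts* h u k m w
    accepts h       u       k       m       UDₖ (D ∷ w) = false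
    accepts h       zero    k       m       UDₖ (U ∷ w) = false
    accepts h       (suc u) zero    m       UDₖ (U ∷ w) = false
    accepts h       (suc u) (suc k) m       UDₖ (U ∷ w) = accepts (suc h) u k m Dₖ w
    accepts h       u       k       m       UUₖ (D ∷ w) = false
    accepts h       zero    k       m       UUₖ (U ∷ w) = false
    accepts h       (suc u) k       zero    UUₖ (U ∷ w) = accepts (suc h) u k 0 UUₖ w ∨ accepts (suc h) u k 0 εₖ w
    accepts h       (suc u) k       (suc m) UUₖ (U ∷ w) =
      accepts (suc h) u k m UDₖ w ∨ (accepts (suc h) u k (suc m) UUₖ w ∨ accepts (suc h) u k (suc m) εₖ w)

    accepts* : ℕ → ℕ → ℕ → ℕ → List Step → Bool
    accepts* h u k m w = accepts h u k m εₖ w ∨ (accepts h u k m Dₖ w ∨ (accepts h u k m UDₖ w ∨ accepts h u k m UUₖ w))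

  IsPath-[] : ∀ h u k m → T ((h ≡ᵇ 0) ∧ (u ≡ᵇ 0) ∧ (k ≡ᵇ 0) ∧ (m ≡ᵇ 0)) → IsPath h u k m []
  IsPath-[] zero zero zero zero _ = tt , refl , refl , refl , refl

  ∨-left : ∀ a {b} → T a → T (a ∨ b)
  ∨-left a {b} t = from (T-∨ {a} {b}) (inj₁ t)

  ∨-right : ∀ a {b} → T b → T (a ∨ b)
  ∨-right a {b} t = from (T-∨ {a} {b}) (inj₂ t)

  ∨-cases : ∀ a b → T (a ∨ b) → T a ⊎ T b
  ∨-cases a b = to (T-∨ {a} {b})

  mutual
    accepts-sound : ∀ h u k m c w → T (accepts h u k m c w) → IsPath h u k m w × kind w ≡ c
    accepts-sound h       u       k       m       εₖ  []      t = IsPath-[] h u k m t , refl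
    accepts-sound (suc h) u       k       m       Dₖ  (D ∷ w) t = IsPath-D∷ w (accepts*-sound h u k m w t) , refl
    accepts-sound h       (suc u) (suc k) m       UDₖ (U ∷ w) t =
      let p , e = accepts-sound (suc h) u k m Dₖ w t in IsPath-U∷ Dₖ w e p refl refl
    accepts-sound h       (suc u) k       zero    UUₖ (U ∷ w) t
      with ∨-cases (accepts (suc h) u k 0 UUₖ w) _ t
    ... | inj₁ t′ = let p , e = accepts-sound (suc h) u k 0 UUₖ w t′ in IsPath-U∷ UUₖ w e p refl refl
    ... | inj₂ t′ = let p , e = accepts-sound (suc h) u k 0 εₖ  w t′ in IsPath-U∷ εₖ  w e p refl refl
    accepts-sound h       (suc u) k       (suc m) UUₖ (U ∷ w) t
      with ∨-cases (accepts (suc h) u k m UDₖ w) _ t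
    ... | inj₁ t′ = let p , e = accepts-sound (suc h) u k m UDₖ w t′ in IsPath-U∷ UDₖ w e p refl refl
    ... | inj₂ t″ with ∨-cases (accepts (suc h) u k (suc m) UUₖ w) _ t″
    ... | inj₁ t′ = let p , e = accepts-sound (suc h) u k (suc m) UUₖ w t′ in IsPath-U∷ UUₖ w e p refl refl
    ... | inj₂ t′ = let p , e = accepts-sound (suc h) u k (suc m) εₖ  w t′ in IsPath-U∷ εₖ  w e p refl refl

    accepts*-sound : ∀ h u k m w → T (accepts* h u k m w) → IsPath h u k m w
    accepts*-sound h u k m w t with ∨-cases (accepts h u k m εₖ w) _ t
    ... | inj₁ t′ = proj₁ (accepts-sound h u k m εₖ w t′)
    ... | inj₂ t₂ with ∨-cases (accepts h u k m Dₖ w) _ t₂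
    ... | inj₁ t′ = proj₁ (accepts-sound h u k m Dₖ w t′)
    ... | inj₂ t₃ with ∨-cases (accepts h u k m UDₖ w) _ t₃
    ... | inj₁ t′ = proj₁ (accepts-sound h u k m UDₖ w t′)
    ... | inj₂ t′ = proj₁ (accepts-sound h u k m UUₖ w t′)

  accepts*-of-kind : ∀ h u k m c w → T (accepts h u k m c w) → T (accepts* h u k m w)
  accepts*-of-kind h u k m εₖ  w t = ∨-left (A εₖ) t
    where A = λ c → accepts h u k m c w
  accepts*-of-kind h u k m Dₖ  w t = ∨-right (A εₖ) (∨-left (A Dₖ) t)
    where A = λ c → accepts h u k m c w
  accepts*-of-kind h u k m UDₖ w t = ∨-right (A εₖ) (∨-right (A Dₖ) (∨-left (A UDₖ) t))
    where A = λ c → accepts h u k m c w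
  accepts*-of-kind h u k m UUₖ w t = ∨-right (A εₖ) (∨-right (A Dₖ) (∨-right (A UDₖ) t))
    where A = λ c → accepts h u k m c w

  accepts-complete : ∀ h u k m w → IsPath h u k m w → T (accepts h u k m (kind w) w)
  accepts-complete zero    zero    zero    zero    []  (v , refl , refl , refl , refl) = tt
  accepts-complete (suc h) u       k       m       []  (v , eu , ed , ek , em) with trans ed (+-suc u h)
  ... | ()
  accepts-complete zero    (suc u) k       m       []  (v , () , _)
  accepts-complete zero    zero    (suc k) m       []  (v , _ , _ , () , _)
  accepts-complete zero    zero    zero    (suc m) []  (v , _ , _ , _ , ())
  accepts-complete zero    u       k       m       (D ∷ w) (() , _)
  accepts-complete (suc h) u       k       m       (D ∷ w) (v , eu , ed , ek , em) =
    accepts*-of-kind h u k m (kind w) w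
      (accepts-complete h u k m w (v , eu , suc-injective (trans ed (+-suc u h)) , ek , em))
  accepts-complete h       zero    k       m       (U ∷ w) (v , () , _)
  accepts-complete h       (suc u) k       m       (U ∷ []) (v , eu , ed , ek , em) with trans ed (cong (_+ h) (sym eu))
  ... | ()
  accepts-complete h       (suc u) zero    m       (U ∷ D ∷ w) (v , _ , _ , () , _)
  accepts-complete h       (suc u) (suc k) m       (U ∷ D ∷ w) (v , eu , ed , ek , em) =
    accepts-complete (suc h) u k m (D ∷ w) (v , suc-injective eu , trans ed (sym (+-suc u h)) , suc-injective ek , em)
  accepts-complete h       (suc u) k       zero    (U ∷ U ∷ D ∷ w) (v , _ , _ , _ , ())
  accepts-complete h       (suc u) k       (suc m) (U ∷ U ∷ D ∷ w) (v , eu , ed , ek , em) = ∨-left (accepts (suc h) u k m UDₖ (U ∷ D ∷ w))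
    (accepts-complete (suc h) u k m (U ∷ D ∷ w) (v , suc-injective eu , trans ed (sym (+-suc u h)) , ek , suc-injective em))
  accepts-complete h       (suc u) k       zero    (U ∷ U ∷ []) (v , eu , ed , ek , em) = ∨-left (accepts (suc h) u k 0 UUₖ (U ∷ []))
    (accepts-complete (suc h) u k zero (U ∷ []) (v , suc-injective eu , trans ed (sym (+-suc u h)) , ek , em))
  accepts-complete h       (suc u) k       (suc m) (U ∷ U ∷ []) (v , eu , ed , ek , em) =
    ∨-right (accepts (suc h) u k m UDₖ (U ∷ [])) (∨-left (accepts (suc h) u k (suc m) UUₖ (U ∷ []))
    (accepts-complete (suc h) u k (suc m) (U ∷ []) (v , suc-injective eu , trans ed (sym (+-suc u h)) , ek , em)))
  accepts-complete h       (suc u) k       zero    (U ∷ U ∷ U ∷ w) (v , eu , ed , ek , em) = ∨-left (accepts (suc h) u k 0 UUₖ (U ∷ U ∷ w))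
    (accepts-complete (suc h) u k zero (U ∷ U ∷ w) (v , suc-injective eu , trans ed (sym (+-suc u h)) , ek , em))
  accepts-complete h       (suc u) k       (suc m) (U ∷ U ∷ U ∷ w) (v , eu , ed , ek , em) =
    ∨-right (accepts (suc h) u k m UDₖ (U ∷ U ∷ w)) (∨-left (accepts (suc h) u k (suc m) UUₖ (U ∷ U ∷ w))
    (accepts-complete (suc h) u k (suc m) (U ∷ U ∷ w) (v , suc-injective eu , trans ed (sym (+-suc u h)) , ek , em)))

  does-≡ : {P : Set} (P? : Dec P) (b : Bool) → (P → T b) → (T b → P) → does P? ≡ b
  does-≡ (yes p) true  _ _ = refl
  does-≡ (yes p) false f _ = ⊥-elim (f p)
  does-≡ (no ¬p) true  _ g = ⊥-elim (¬p (g tt))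
  does-≡ (no ¬p) false _ _ = refl

  paths : Kind → Table
  paths c h u k m = count (accepts h u k m c) (words (u + u + h))

  paths* : Table
  paths* h u k m = count (accepts* h u k m) (words (u + u + h))

  wnkm≡paths* : ∀ n k m → wnkm n k m ≡ paths* 0 n k m
  wnkm≡paths* n k m = begin
    length (filter (WP? n k m) (words (n + n)))     ≡⟨ length-filter≡count (WP? n k m) (words (n + n)) ⟩
    count (λ w → does (WP? n k m w)) (words (n + n)) ≡⟨ count-cong does-WP? (words (n + n)) ⟩
    count (accepts* 0 n k m) (words (n + n))        ≡⟨ cong (λ ℓ → count (accepts* 0 n k m) (words ℓ)) (sym (+-identityʳ (n + n))) ⟩
    paths* 0 n k m                                   ∎
    where
    does-WP? : ∀ w → does (WP? n k m w) ≡ accepts* 0 n k m w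
    does-WP? w = does-≡ (WP? n k m w) (accepts* 0 n k m w)
      (λ p → accepts*-of-kind 0 n k m (kind w) w (accepts-complete 0 n k m w (to (WP⇔IsPath n k m w) p)))
      (λ t → from (WP⇔IsPath n k m w) (accepts*-sound 0 n k m w t))

  kinds-differ : ∀ {h u k m h′ u′ k′ m′} c c′ → c ≢ c′ → ∀ w →
                 T (accepts h u k m c w) → T (accepts h′ u′ k′ m′ c′ w) → ⊥
  kinds-differ {h} {u} {k} {m} {h′} {u′} {k′} {m′} c c′ c≢c′ w t t′ =
    c≢c′ (trans (sym (proj₂ (accepts-sound h u k m c w t))) (proj₂ (accepts-sound h′ u′ k′ m′ c′ w t′)))

  paths*-by-kind : ∀ h u k m →
    paths* h u k m ≡ paths εₖ h u k m + (paths Dₖ h u k m + (paths UDₖ h u k m + paths UUₖ h u k m))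
  paths*-by-kind h u k m =
    trans (count-∨ ε-excl ws) (cong (paths εₖ h u k m +_)
      (trans (count-∨ D-excl ws) (cong (paths Dₖ h u k m +_) (count-∨ (kinds-differ UDₖ UUₖ (λ ())) ws))))
    where
    ws = words (u + u + h)
    A : Kind → List Step → Bool
    A c = accepts h u k m c
    ε-excl : ∀ w → T (A εₖ w) → T (A Dₖ w ∨ (A UDₖ w ∨ A UUₖ w)) → ⊥
    ε-excl w t t′ = [ kinds-differ εₖ Dₖ (λ ()) w t ,
                      ([ kinds-differ εₖ UDₖ (λ ()) w t , kinds-differ εₖ UUₖ (λ ()) w t ] ∘ ∨-cases (A UDₖ w) _) ]
                    (∨-cases (A Dₖ w) _ t′)
    D-excl : ∀ w → T (A Dₖ w) → T (A UDₖ w ∨ A UUₖ w) → ⊥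
    D-excl w t t′ = [ kinds-differ Dₖ UDₖ (λ ()) w t , kinds-differ Dₖ UUₖ (λ ()) w t ] (∨-cases (A UDₖ w) _ t′)

  count-words-step : ∀ p {ℓ ℓ′} → ℓ ≡ suc ℓ′ →
    count p (words ℓ) ≡ count (λ w → p (U ∷ w)) (words ℓ′) + count (λ w → p (D ∷ w)) (words ℓ′)
  count-words-step p {ℓ′ = ℓ′} refl = count-words-suc p ℓ′

  length-suc-h : ∀ u h → u + u + suc h ≡ suc (u + u + h)
  length-suc-h u h = +-suc (u + u) h

  length-suc-u : ∀ u h → suc u + suc u + h ≡ suc (u + u + suc h)
  length-suc-u u h = cong suc (trans (cong (_+ h) (+-suc u u)) (sym (+-suc (u + u) h)))

  paths-ε-suc-h : ∀ h u k m → paths εₖ (suc h) u k m ≡ 0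
  paths-ε-suc-h h u k m = trans (count-words-step _ (length-suc-h u h))
    (cong₂ _+_ (count-none (λ _ → refl) (words (u + u + h))) (count-none (λ _ → refl) (words (u + u + h))))

  paths-ε-suc-u : ∀ h u k m → paths εₖ h (suc u) k m ≡ 0
  paths-ε-suc-u h u k m = trans (count-words-step _ (length-suc-u u h))
    (cong₂ _+_ (count-none (λ _ → refl) (words (u + u + suc h))) (count-none (λ _ → refl) (words (u + u + suc h))))

  paths-D : ∀ h u k m → paths Dₖ (suc h) u k m ≡ paths* h u k m
  paths-D h u k m = trans (count-words-step _ (length-suc-h u h))
    (cong (_+ paths* h u k m) (count-none (λ _ → refl) (words (u + u + h))))

  paths-D-zero : ∀ u k m → paths Dₖ 0 u k m ≡ 0
  paths-D-zero u k m = count-none (λ { [] → refl ; (U ∷ _) → refl ; (D ∷ _) → refl }) (words (u + u + 0))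

  paths-UD : ∀ h u k m → paths UDₖ h (suc u) (suc k) m ≡ paths Dₖ (suc h) u k m
  paths-UD h u k m = trans (count-words-step _ (length-suc-u u h))
    (trans (cong (paths Dₖ (suc h) u k m +_) (count-none (λ _ → refl) (words (u + u + suc h)))) (+-identityʳ _))

  paths-UD-zero-u : ∀ h k m → paths UDₖ h 0 k m ≡ 0
  paths-UD-zero-u h k m = count-none (λ { [] → refl ; (U ∷ _) → refl ; (D ∷ _) → refl }) (words h)

  paths-UD-zero-k : ∀ h u m → paths UDₖ h u 0 m ≡ 0
  paths-UD-zero-k h zero    m = paths-UD-zero-u h 0 m
  paths-UD-zero-k h (suc u) m = count-none (λ { [] → refl ; (U ∷ _) → refl ; (D ∷ _) → refl }) (words (suc u + suc u + h))

  paths-UU-zero-u : ∀ h k m → paths UUₖ h 0 k m ≡ 0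
  paths-UU-zero-u h k m = count-none (λ { [] → refl ; (U ∷ _) → refl ; (D ∷ _) → refl }) (words h)

  ↓uk-paths* : ∀ h u k m → ↓uk paths* h u k m ≡ paths UDₖ (suc h) u k m
  ↓uk-paths* h zero    k       m = sym (paths-UD-zero-u (suc h) k m)
  ↓uk-paths* h (suc u) zero    m = sym (paths-UD-zero-k (suc h) (suc u) m)
  ↓uk-paths* h (suc u) (suc k) m = sym (trans (paths-UD (suc h) u k m) (paths-D (suc h) u k m))

  ↓h-paths* : ∀ h u k m → ↓h paths* h u k m ≡ paths Dₖ h (suc u) k m
  ↓h-paths* zero    u k m = sym (paths-D-zero (suc u) k m)
  ↓h-paths* (suc h) u k m = sym (paths-D h (suc u) k m)

  ↓k-paths* : ∀ h u k m → ↓k paths* h u k m ≡ paths UDₖ h (suc u) k m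
  ↓k-paths* h u zero    m = sym (paths-UD-zero-k h (suc u) m)
  ↓k-paths* h u (suc k) m = sym (trans (paths-UD h u k m) (paths-D h u k m))

  paths-UU : ∀ h u k m → paths UUₖ h (suc u) k m ≡ ↓ukm paths* h u k m + paths UUₖ (suc h) u k m
  paths-UU h u k m = trans (count-words-step _ (length-suc-u u h))
    (trans (trans (cong (count (λ w → accepts h (suc u) k m UUₖ (U ∷ w)) ws +_) (count-none (λ _ → refl) ws))
                  (+-identityʳ _)) (after-U m))
    where
    ws = words (u + u + suc h)
    after-U : ∀ m → count (λ w → accepts h (suc u) k m UUₖ (U ∷ w)) ws ≡ ↓ukm paths* h u k m + paths UUₖ (suc h) u k m
    after-U zero = begin
      count (λ w → accepts (suc h) u k 0 UUₖ w ∨ accepts (suc h) u k 0 εₖ w) ws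
        ≡⟨ count-∨ (kinds-differ UUₖ εₖ (λ ())) ws ⟩
      paths UUₖ (suc h) u k 0 + paths εₖ (suc h) u k 0
        ≡⟨ trans (cong (paths UUₖ (suc h) u k 0 +_) (paths-ε-suc-h h u k 0)) (+-identityʳ _) ⟩
      paths UUₖ (suc h) u k 0 ∎
    after-U (suc m) = begin
      count (λ w → accepts (suc h) u k m UDₖ w ∨ (accepts (suc h) u k (suc m) UUₖ w ∨ accepts (suc h) u k (suc m) εₖ w)) ws
        ≡⟨ count-∨ UD-excl ws ⟩
      paths UDₖ (suc h) u k m + count (λ w → accepts (suc h) u k (suc m) UUₖ w ∨ accepts (suc h) u k (suc m) εₖ w) ws
        ≡⟨ cong₂ _+_ (sym (↓uk-paths* h u k m)) (count-∨ (kinds-differ UUₖ εₖ (λ ())) ws) ⟩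
      ↓uk paths* h u k m + (paths UUₖ (suc h) u k (suc m) + paths εₖ (suc h) u k (suc m))
        ≡⟨ cong (λ n → ↓uk paths* h u k m + n) (trans (cong (paths UUₖ (suc h) u k (suc m) +_) (paths-ε-suc-h h u k (suc m))) (+-identityʳ _)) ⟩
      ↓uk paths* h u k m + paths UUₖ (suc h) u k (suc m) ∎
      where
      UD-excl : ∀ w → T (accepts (suc h) u k m UDₖ w) → T (accepts (suc h) u k (suc m) UUₖ w ∨ accepts (suc h) u k (suc m) εₖ w) → ⊥
      UD-excl w t t′ = [ kinds-differ UDₖ UUₖ (λ ()) w t , kinds-differ UDₖ εₖ (λ ()) w t ] (∨-cases (accepts (suc h) u k (suc m) UUₖ w) _ t′)

  paths*-recurrence : Recurrence paths*
  paths*-recurrence h u k m = begin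
    paths* h (suc u) k m + paths* h u k m + ↓uk paths* h u k m
      ≡⟨ cong₂ (λ x z → x + paths* h u k m + z)
           (trans (paths*-by-kind h (suc u) k m)
             (cong₂ _+_ (paths-ε-suc-u h u k m)
               (cong₂ _+_ (sym (↓h-paths* h u k m)) (cong₂ _+_ (sym (↓k-paths* h u k m)) (paths-UU h u k m)))))
           (↓uk-paths* h u k m) ⟩
    0 + (a + (b + (c + x))) + y + z
      ≡⟨ solve 6 (λ a b c x y z → con 0 :+ (a :+ (b :+ (c :+ x))) :+ y :+ z := a :+ b :+ c :+ (con 0 :+ (y :+ (z :+ x))))
               refl a b c x y z ⟩
    a + b + c + (0 + (y + (z + x)))
      ≡⟨ cong (a + b + c +_) (sym (trans (paths*-by-kind (suc h) u k m)
           (cong₂ _+_ (paths-ε-suc-h h u k m) (cong₂ _+_ (paths-D h u k m) refl)))) ⟩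
    a + b + c + paths* (suc h) u k m ∎
    where
    a = ↓h paths* h u k m
    b = ↓k paths* h u k m
    c = ↓ukm paths* h u k m
    x = paths UUₖ (suc h) u k m
    y = paths* h u k m
    z = paths UDₖ (suc h) u k m

  paths*-flat : ∀ h k m → paths* h 0 k m ≡ indicator ((k ≡ᵇ 0) ∧ (m ≡ᵇ 0))
  paths*-flat zero    k m = trans (paths*-by-kind 0 0 k m)
    (trans (cong₂ _+_ (+-identityʳ _) (cong₂ _+_ (paths-D-zero 0 k m) (cong₂ _+_ (paths-UD-zero-u 0 k m) (paths-UU-zero-u 0 k m))))
           (+-identityʳ _))
  paths*-flat (suc h) k m = trans (paths*-by-kind (suc h) 0 k m)
    (trans (cong₂ _+_ (paths-ε-suc-h h 0 k m) (cong₂ _+_ (paths-D h 0 k m) (cong₂ _+_ (paths-UD-zero-u (suc h) k m) (paths-UU-zero-u (suc h) k m))))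
           (trans (+-identityʳ _) (paths*-flat h k m)))

  paths*-closed-form : ∀ h u k m → HasClosedForm paths* h u k m
  paths*-closed-form h u k m = closed-form paths* paths*-recurrence flat u h k m
    where
    flat : ∀ h k m → HasClosedForm paths* h 0 k m
    flat h zero    zero    = cong (λ n → 1 * n) (paths*-flat h 0 0)
    flat h (suc k) zero    = cong (λ n → 1 * n) (paths*-flat h (suc k) 0)
    flat h zero    (suc a) = trans (cong (suc a *_) (paths*-flat h 0 (suc a))) (*-zeroʳ (suc a))
    flat h (suc K) (suc a) = trans (cong (suc a *_) (paths*-flat h (suc K) (suc a))) (*-zeroʳ (suc a))

module Coefficients where

  open import Defs
  open import Data.Nat using (ℕ; zero; suc; pred; _+_; _*_; _∸_; _≤_; _<_; _≤?_; s≤s; NonZero)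
  open import Data.Nat.Properties
  open import Data.Nat.Combinatorics using (_C_)
  open import Data.Nat.Solver using (module +-*-Solver)
  open import Data.Integer using (+_; _⊖_) renaming (_-_ to _-ℤ_)
  import Data.Integer.Properties as ℤ
  open import Data.Rational using (_/_; 0ℚ) renaming (_*_ to _*ℚ_)
  import Data.Rational.Properties as ℚ
  open import Data.Rational.Unnormalised.Base using (mkℚᵘ; *≡*)
  import Data.Rational.Unnormalised.Properties as ℚᵘ
  open import Data.Empty using (⊥-elim)
  open import Relation.Nullary using (Dec; yes; no; ¬_)
  open import Relation.Binary.PropositionalEquality
  open +-*-Solver
  open ≡-Reasoning
  open Binomial
  open ClosedForm using (δ; δ-diag; δ->; gapBinom; gapBinom-≤; gapBinom-+)
  open Paths using (paths*; wnkm≡paths*; paths*-closed-form)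

  wnkm-no-UUD : ∀ n k → wnkm n k 0 ≡ δ n k
  wnkm-no-UUD n k = begin
    wnkm n k 0                  ≡⟨ wnkm≡paths* n k 0 ⟩
    paths* 0 n k 0              ≡⟨ sym (*-identityˡ _) ⟩
    1 * paths* 0 n k 0          ≡⟨ paths*-closed-form 0 n k 0 ⟩
    δ n k * binom (k + 0) k     ≡⟨ cong (δ n k *_) (trans (cong (λ x → binom x k) (+-identityʳ k)) (binom-diag k)) ⟩
    δ n k * 1                   ≡⟨ *-identityʳ (δ n k) ⟩
    δ n k                       ∎

  wnkm-UUD : ∀ n K a → suc a * wnkm n (suc K) (suc a) ≡ gapBinom n K a * binom K a * (n C K)
  wnkm-UUD n K a = begin
    suc a * wnkm n (suc K) (suc a)       ≡⟨ cong (suc a *_) (wnkm≡paths* n (suc K) (suc a)) ⟩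
    suc a * paths* 0 n (suc K) (suc a)   ≡⟨ paths*-closed-form 0 n (suc K) (suc a) ⟩
    gapBinom n K a * binom K a * (1 * binom (n + 0) K)
      ≡⟨ cong (gapBinom n K a * binom K a *_)
           (trans (*-identityˡ _) (trans (cong (λ x → binom x K) (+-identityʳ n)) (binom≡C n K))) ⟩
    gapBinom n K a * binom K a * (n C K) ∎

  wnkm-UUD-vanishes : ∀ n K a → gapBinom n K a ≡ 0 → wnkm n (suc K) (suc a) ≡ 0
  wnkm-UUD-vanishes n K a e = *-cancelˡ-≡ _ 0 (suc a)
    (trans (wnkm-UUD n K a) (trans (cong (λ g → g * binom K a * (n C K)) e) (sym (*-zeroʳ (suc a)))))

  cancel-absorption : ∀ a w B s X Y Z → suc a * w ≡ X * Y * Z → suc a * B ≡ s * X → w * s ≡ Z * (B * Y)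
  cancel-absorption a w B s X Y Z e₁ e₂ = *-cancelˡ-≡ _ _ (suc a) (begin
    suc a * (w * s)          ≡⟨ sym (*-assoc (suc a) w s) ⟩
    suc a * w * s            ≡⟨ cong (_* s) e₁ ⟩
    X * Y * Z * s            ≡⟨ solve 4 (λ X Y Z s → X :* Y :* Z :* s := Z :* ((s :* X) :* Y)) refl X Y Z s ⟩
    Z * ((s * X) * Y)        ≡⟨ cong (λ t → Z * (t * Y)) (sym e₂) ⟩
    Z * ((suc a * B) * Y)    ≡⟨ solve 4 (λ a Z B Y → Z :* ((a :* B) :* Y) := a :* (Z :* (B :* Y))) refl (suc a) Z B Y ⟩
    suc a * (Z * (B * Y))    ∎)

  cross-cancel : ∀ s x t y Z W → x * suc s ≡ Z * y → suc s * W ≡ t * Z → x * t ≡ W * y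
  cross-cancel s x t y Z W e₁ e₂ = *-cancelˡ-≡ _ _ (suc s) (begin
    suc s * (x * t)      ≡⟨ solve 3 (λ s x t → s :* (x :* t) := x :* s :* t) refl (suc s) x t ⟩
    x * suc s * t        ≡⟨ cong (_* t) e₁ ⟩
    Z * y * t            ≡⟨ solve 3 (λ Z y t → Z :* y :* t := t :* Z :* y) refl Z y t ⟩
    t * Z * y            ≡⟨ cong (_* y) (sym e₂) ⟩
    suc s * W * y        ≡⟨ *-assoc (suc s) W y ⟩
    suc s * (W * y)      ∎)

  /-cross : ∀ a b c d → a * suc d ≡ c * suc b → (+ a) / suc b ≡ (+ c) / suc d
  /-cross a b c d e = ℚ.fromℚᵘ-cong {mkℚᵘ (+ a) b} {mkℚᵘ (+ c) d}
    (*≡* (trans (sym (ℤ.pos-* a (suc d))) (trans (cong +_ e) (ℤ.pos-* c (suc b)))))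

  /-*-/ : ∀ a b c d → ((+ a) / suc b) *ℚ ((+ c) / suc d) ≡ (+ (a * c)) / (suc b * suc d)
  /-*-/ a b c d = ℚ.toℚᵘ-injective (ℚᵘ.≃-trans (ℚ.toℚᵘ-homo-* ((+ a) / suc b) ((+ c) / suc d))
    (ℚᵘ.≃-trans (ℚᵘ.*-cong (ℚ.toℚᵘ-fromℚᵘ (mkℚᵘ (+ a) b)) (ℚ.toℚᵘ-fromℚᵘ (mkℚᵘ (+ c) d)))
    (ℚᵘ.≃-trans (ℚᵘ.≃-reflexive (cong (λ z → mkℚᵘ z (pred (suc b * suc d))) (sym (ℤ.pos-* a c))))
                (ℚᵘ.≃-sym (ℚ.toℚᵘ-fromℚᵘ (mkℚᵘ (+ (a * c)) (pred (suc b * suc d))))))))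

  ℕ→ℚ-fraction : ∀ w N d c → w * suc d ≡ N * c → ℕ→ℚ w ≡ ((+ N) / suc d) *ℚ ℕ→ℚ c
  ℕ→ℚ-fraction w N d c e = trans
    (/-cross w 0 (N * c) (d * 1) (trans (cong (λ x → w * suc x) (*-identityʳ d)) (trans e (sym (*-identityʳ (N * c))))))
    (sym (/-*-/ N d c 0))

  /-*-cancel : ∀ N j b x → ((+ N) / suc j) *ℚ (((+ suc j) / suc b) *ℚ x) ≡ ((+ N) / suc b) *ℚ x
  /-*-cancel N j b x = trans (sym (ℚ.*-assoc ((+ N) / suc j) _ x))
    (cong (_*ℚ x) (trans (/-*-/ N j (suc j) b) (/-cross (N * suc j) (b + j * suc b) N b (*-assoc N (suc j) (suc b)))))

  -- wnkm behind an opaque name: a with-abstraction over a goal mentioning wnkm n k m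
  -- would otherwise normalise its large definition.
  opaque
    wnkm′ : ℕ → ℕ → ℕ → ℕ
    wnkm′ = wnkm

  opaque
    unfolding wnkm′
    wnkm′≡wnkm : ∀ n k m → wnkm′ n k m ≡ wnkm n k m
    wnkm′≡wnkm n k m = refl

  Wcoeff-≤ : ∀ n k m → m ≤ k → Wcoeff n k m ≡ ℕ→ℚ (wnkm′ n k m)
  Wcoeff-≤ n k m m≤k with m ≤? k
  ... | yes _   = cong ℕ→ℚ (sym (wnkm′≡wnkm n k m))
  ... | no  m≰k = ⊥-elim (m≰k m≤k)

  Wcoeff-≰ : ∀ n k m → ¬ m ≤ k → Wcoeff n k m ≡ 0ℚ
  Wcoeff-≰ n k m m≰k with m ≤? k
  ... | yes m≤k = ⊥-elim (m≰k m≤k)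
  ... | no  _   = refl

  narCoeff-≤ : ∀ r N m → m ≤ N ∸ r →
    narCoeff r N m ≡ ((+ suc r) / suc N) *ℚ ℕ→ℚ ((suc N C m) * binomℤ ((+ N) -ℤ (+ suc r)) ((+ m) -ℤ (+ 1)))
  narCoeff-≤ r N m m≤ with m ≤? N ∸ r
  ... | yes _  = refl
  ... | no  m≰ = ⊥-elim (m≰ m≤)

  narCoeff-≰ : ∀ r N m → ¬ m ≤ N ∸ r → narCoeff r N m ≡ 0ℚ
  narCoeff-≰ r N m m≰ with m ≤? N ∸ r
  ... | yes m≤ = ⊥-elim (m≰ m≤)
  ... | no  _  = refl

  coefficients-agree : ∀ n k r N m q → N ∸ r ≤ k →
    (m ≤ N ∸ r → ℕ→ℚ (wnkm n k m)
       ≡ q *ℚ (((+ suc r) / suc N) *ℚ ℕ→ℚ ((suc N C m) * binomℤ ((+ N) -ℤ (+ suc r)) ((+ m) -ℤ (+ 1))))) →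
    (m ≤ k → N ∸ r < m → wnkm n k m ≡ 0) →
    Wcoeff n k m ≡ q *ℚ narCoeff r N m
  coefficients-agree n k r N m q N∸r≤k agree vanish = by-cases (m ≤? k) (m ≤? N ∸ r)
    where
    by-cases : Dec (m ≤ k) → Dec (m ≤ N ∸ r) → Wcoeff n k m ≡ q *ℚ narCoeff r N m
    by-cases (yes m≤k) (yes m≤N∸r) =
      trans (Wcoeff-≤ n k m m≤k) (trans (cong ℕ→ℚ (wnkm′≡wnkm n k m))
        (trans (agree m≤N∸r) (cong (q *ℚ_) (sym (narCoeff-≤ r N m m≤N∸r)))))
    by-cases (yes m≤k) (no m≰N∸r) = begin
      Wcoeff n k m          ≡⟨ Wcoeff-≤ n k m m≤k ⟩
      ℕ→ℚ (wnkm′ n k m)     ≡⟨ cong ℕ→ℚ (trans (wnkm′≡wnkm n k m) (vanish m≤k (≰⇒> m≰N∸r))) ⟩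
      0ℚ                    ≡⟨ sym (ℚ.*-zeroʳ q) ⟩
      q *ℚ 0ℚ               ≡⟨ cong (q *ℚ_) (sym (narCoeff-≰ r N m m≰N∸r)) ⟩
      q *ℚ narCoeff r N m   ∎
    by-cases (no m≰k) (yes m≤N∸r) = ⊥-elim (m≰k (≤-trans m≤N∸r N∸r≤k))
    by-cases (no m≰k) (no m≰N∸r) =
      trans (Wcoeff-≰ n k m m≰k) (trans (sym (ℚ.*-zeroʳ q)) (cong (q *ℚ_) (sym (narCoeff-≰ r N m m≰N∸r))))

  +-−-cancel : ∀ a b → (+ (a + b)) -ℤ (+ b) ≡ + a
  +-−-cancel a b = trans (ℤ.m-n≡m⊖n (a + b) b) (trans (ℤ.⊖-≥ (m≤n+m b a)) (cong +_ (m+n∸n≡m a b)))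

  part-a-suc : ∀ K j′ m → let n = suc K + suc K + suc j′ in
    Wcoeff n (suc K) m ≡ ((+ (n C K)) / suc j′) *ℚ narCoeff j′ (K + suc j′) m
  part-a-suc K j′ m = coefficients-agree n (suc K) j′ b m q (≤-reflexive b∸j′≡1+K) main
    (λ m≤1+K b∸j′<m → ⊥-elim (<⇒≱ b∸j′<m (subst (m ≤_) (sym b∸j′≡1+K) m≤1+K)))
    where
    n = suc K + suc K + suc j′
    b = K + suc j′
    q = (+ (n C K)) / suc j′
    b∸j′≡1+K : b ∸ j′ ≡ suc K
    b∸j′≡1+K = trans (cong (_∸ j′) (+-suc K j′)) (m+n∸n≡m (suc K) j′)
    n≡K+2+b : n ≡ K + suc (suc b)
    n≡K+2+b = solve 2 (λ K j → con 1 :+ K :+ (con 1 :+ K) :+ (con 1 :+ j) := K :+ (con 2 :+ (K :+ (con 1 :+ j)))) refl K j′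
    scaled : ∀ m → wnkm n (suc K) m * suc b ≡ (n C K) * ((suc b C m) * binomℤ (+ K) ((+ m) -ℤ (+ 1)))
    scaled zero    = begin
      wnkm n (suc K) 0 * suc b  ≡⟨ cong (_* suc b) (trans (wnkm-no-UUD n (suc K)) (δ-> n (suc K) 1+K<n)) ⟩
      0                         ≡⟨ sym (trans (cong ((n C K) *_) (*-zeroʳ (suc b C 0))) (*-zeroʳ (n C K))) ⟩
      (n C K) * ((suc b C 0) * 0) ∎
      where 1+K<n = s≤s (≤-trans (m≤n+m (suc K) K) (m≤m+n (K + suc K) (suc j′)))
    scaled (suc a) = cancel-absorption a (wnkm n (suc K) (suc a)) (suc b C suc a) (suc b) (binom b a) (K C a) (n C K)
      (trans (wnkm-UUD n K a) (cong₂ (λ g x → g * x * (n C K))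
        (trans (cong (λ x → gapBinom x K a) n≡K+2+b) (gapBinom-+ K b a)) (binom≡C K a)))
      (trans (cong (suc a *_) (sym (binom≡C (suc b) (suc a)))) (binom-absorption b a))
    main : m ≤ b ∸ j′ → ℕ→ℚ (wnkm n (suc K) m)
      ≡ q *ℚ (((+ suc j′) / suc b) *ℚ ℕ→ℚ ((suc b C m) * binomℤ ((+ b) -ℤ (+ suc j′)) ((+ m) -ℤ (+ 1))))
    main _ = trans (ℕ→ℚ-fraction (wnkm n (suc K) m) (n C K) b _ (scaled m)) (trans (sym (/-*-cancel (n C K) j′ b _))
      (cong (λ z → q *ℚ (((+ suc j′) / suc b) *ℚ ℕ→ℚ ((suc b C m) * binomℤ z ((+ m) -ℤ (+ 1)))))
            (sym (+-−-cancel K (suc j′)))))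

  part-b : ∀ K m → Wcoeff (suc K + suc K) (suc K) m ≡ partBcoeff (suc K) m
  part-b K zero    = cong ℕ→ℚ (trans (wnkm-no-UUD (suc K + suc K) (suc K)) (δ-> (suc K + suc K) (suc K) (s≤s (m≤n+m (suc K) K))))
  part-b K (suc a) with suc a ≤? suc K
  ... | no  _ = refl
  ... | yes _ = ℕ→ℚ-fraction w Cₖ (suc K) (Y * C₊) (cross-cancel K w (suc (suc K)) (Y * C₊) Z Cₖ
      (trans (cancel-absorption a w C₊ (suc K) Y Y Z e₁ e₂) (cong (Z *_) (*-comm C₊ Y))) e₃)
    where
    n = suc K + suc K
    w = wnkm n (suc K) (suc a)
    Cₖ = n C suc K
    Y = K C a
    C₊ = suc K C suc a
    Z = n C K
    n≡K+2+K : n ≡ K + suc (suc K)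
    n≡K+2+K = sym (+-suc K (suc K))
    e₁ : suc a * w ≡ Y * Y * Z
    e₁ = trans (wnkm-UUD n K a) (trans
      (cong (λ g → g * binom K a * Z) (trans (cong (λ x → gapBinom x K a) n≡K+2+K) (gapBinom-+ K K a)))
      (cong (λ b → b * b * Z) (binom≡C K a)))
    e₂ : suc a * C₊ ≡ suc K * Y
    e₂ = trans (cong (suc a *_) (sym (binom≡C (suc K) (suc a)))) (trans (binom-absorption K a) (cong (suc K *_) (binom≡C K a)))
    e₃ : suc K * Cₖ ≡ suc (suc K) * Z
    e₃ = subst (λ x → suc K * (x C suc K) ≡ suc (suc K) * (x C K)) (sym n≡K+2+K)
      (subst₂ (λ p q → suc K * p ≡ suc (suc K) * q) (binom≡C (K + suc (suc K)) (suc K)) (binom≡C (K + suc (suc K)) K) (binom-ratio K (suc (suc K))))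

  part-c-scaled : ∀ j′ e m → m ≤ e → let K = j′ + e; n = suc K + e in
    wnkm n (suc K) m * suc K ≡ (n C K) * ((suc K C m) * binomℤ (e ⊖ 1) ((+ m) -ℤ (+ 1)))
  part-c-scaled j′ zero zero _ = begin
    wnkm n (suc K) 0 * suc K  ≡⟨ cong (_* suc K) w≡1 ⟩
    1 * suc K                 ≡⟨ trans (*-identityˡ (suc K)) (sym (*-identityʳ (suc K))) ⟩
    suc K * 1                 ≡⟨ cong (_* 1) (sym (trans (sym (binom≡C n K)) (trans (cong (λ x → binom x K) (+-identityʳ (suc K))) (binom-suc-diag K)))) ⟩
    (n C K) * 1               ∎
    where
    K = j′ + 0
    n = suc K + 0
    w≡1 : wnkm n (suc K) 0 ≡ 1
    w≡1 = trans (wnkm-no-UUD n (suc K)) (trans (cong (λ x → δ x (suc K)) (+-identityʳ (suc K))) (δ-diag (suc K)))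
  part-c-scaled j′ (suc e′) zero _ = begin
    wnkm n (suc K) 0 * suc K  ≡⟨ cong (_* suc K) (trans (wnkm-no-UUD n (suc K)) (δ-> n (suc K) 1+K<n)) ⟩
    0                         ≡⟨ sym (trans (cong ((n C K) *_) (*-zeroʳ (suc K C 0))) (*-zeroʳ (n C K))) ⟩
    (n C K) * ((suc K C 0) * 0) ∎
    where
    K = j′ + suc e′
    n = suc K + suc e′
    1+K<n : suc K < n
    1+K<n = s≤s (subst (suc K ≤_) (sym (+-suc K e′)) (s≤s (m≤m+n K e′)))
  part-c-scaled j′ (suc e′) (suc a) _ =
    cancel-absorption a (wnkm n (suc K) (suc a)) (suc K C suc a) (suc K) (binom K a) (e′ C a) (n C K)
      (trans (wnkm-UUD n K a) (trans
        (cong (λ g → g * binom K a * (n C K)) (trans (cong (λ x → gapBinom x K a) (sym (+-suc K (suc e′)))) (gapBinom-+ K e′ a)))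
        (cong (_* (n C K)) (trans (*-comm (binom e′ a) (binom K a)) (cong (binom K a *_) (binom≡C e′ a))))))
      (trans (cong (suc a *_) (sym (binom≡C (suc K) (suc a)))) (binom-absorption K a))
    where
    K = j′ + suc e′
    n = suc K + suc e′

  part-c-vanishes : ∀ j′ e a → e ≤ a → let K = j′ + e in wnkm (suc K + e) (suc K) (suc a) ≡ 0
  part-c-vanishes j′ zero     a _ =
    wnkm-UUD-vanishes (suc K + 0) K a (gapBinom-≤ (suc K + 0) K a (≤-reflexive (+-identityʳ (suc K))))
    where K = j′ + 0
  part-c-vanishes j′ (suc e′) a e′<a =
    wnkm-UUD-vanishes (suc K + suc e′) K a
      (trans (cong (λ x → gapBinom x K a) (sym (+-suc K (suc e′)))) (trans (gapBinom-+ K e′ a) (binom-< e′<a)))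
    where K = j′ + suc e′

  part-c-gap : ∀ j′ e m → let K = j′ + e; n = suc K + e in
    Wcoeff n (suc K) m ≡ ((+ (n C K)) / suc j′) *ℚ narCoeff j′ K m
  part-c-gap j′ e m = coefficients-agree n (suc K) j′ K m q K∸j′≤1+K main vanish
    where
    K = j′ + e
    n = suc K + e
    q = (+ (n C K)) / suc j′
    K∸j′≡e : K ∸ j′ ≡ e
    K∸j′≡e = m+n∸m≡n j′ e
    K∸j′≤1+K : K ∸ j′ ≤ suc K
    K∸j′≤1+K = subst (_≤ suc K) (sym K∸j′≡e) (≤-trans (m≤n+m e j′) (n≤1+n K))
    K−[1+j′]≡e⊖1 : (+ K) -ℤ (+ suc j′) ≡ e ⊖ 1
    K−[1+j′]≡e⊖1 = trans (ℤ.m-n≡m⊖n K (suc j′)) (trans (cong (K ⊖_) (+-comm 1 j′)) (ℤ.+-cancelˡ-⊖ j′ e 1))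
    main : m ≤ K ∸ j′ → ℕ→ℚ (wnkm n (suc K) m)
      ≡ q *ℚ (((+ suc j′) / suc K) *ℚ ℕ→ℚ ((suc K C m) * binomℤ ((+ K) -ℤ (+ suc j′)) ((+ m) -ℤ (+ 1))))
    main m≤K∸j′ = trans
      (ℕ→ℚ-fraction (wnkm n (suc K) m) (n C K) K _ (part-c-scaled j′ e m (subst (m ≤_) K∸j′≡e m≤K∸j′)))
      (trans (sym (/-*-cancel (n C K) j′ K _))
             (cong (λ z → q *ℚ (((+ suc j′) / suc K) *ℚ ℕ→ℚ ((suc K C m) * binomℤ z ((+ m) -ℤ (+ 1))))) (sym K−[1+j′]≡e⊖1)))
    vanish : ∀ {m} → m ≤ suc K → K ∸ j′ < m → wnkm n (suc K) m ≡ 0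
    vanish {suc a} _ K∸j′<1+a = part-c-vanishes j′ e a (subst (_≤ a) K∸j′≡e (≤-pred K∸j′<1+a))

  part-c-suc : ∀ K j′ → j′ ≤ K → ∀ m → let n = suc K + suc K ∸ suc j′ in
    Wcoeff n (suc K) m ≡ ((+ (n C K)) / suc j′) *ℚ narCoeff j′ K m
  part-c-suc K j′ j′≤K m = via-gap (K ∸ j′) K (m+[n∸m]≡n j′≤K)
    where
    via-gap : ∀ e K → j′ + e ≡ K → let n = suc K + suc K ∸ suc j′ in
      Wcoeff n (suc K) m ≡ ((+ (n C K)) / suc j′) *ℚ narCoeff j′ K m
    via-gap e _ refl = subst (λ n → Wcoeff n (suc (j′ + e)) m ≡ ((+ (n C (j′ + e))) / suc j′) *ℚ narCoeff j′ (j′ + e) m)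
      (sym n≡) (part-c-gap j′ e m)
      where
      n≡ : suc (j′ + e) + suc (j′ + e) ∸ suc j′ ≡ suc (j′ + e) + e
      n≡ = trans (cong (_∸ j′) (+-assoc j′ e (suc (j′ + e)))) (trans (m+n∸m≡n j′ (e + suc (j′ + e))) (+-comm e (suc (j′ + e))))

  part-a : ∀ K j .{{_ : NonZero j}} m →
    Wcoeff (suc K + suc K + j) (suc K) m ≡ ((+ ((suc K + suc K + j) C K)) / j) *ℚ narCoeff (j ∸ 1) (suc K + j ∸ 1) m
  part-a K (suc j′) m = part-a-suc K j′ m

  part-c : ∀ K j .{{_ : NonZero j}} → j ≤ suc K → ∀ m →
    Wcoeff (suc K + suc K ∸ j) (suc K) m ≡ ((+ ((suc K + suc K ∸ j) C K)) / j) *ℚ narCoeff (j ∸ 1) K m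
  part-c K (suc j′) (s≤s j′≤K) m = part-c-suc K j′ j′≤K m

open import Defs
open import Data.Nat using (ℕ; suc; _+_; _∸_; _≤_; NonZero)
open import Data.Nat.Combinatorics using (_C_)
open import Data.Integer using (+_)
open import Data.Rational using (ℚ; _/_; _*_)
open import Data.Product using (_×_; _,_)
open import Relation.Binary.PropositionalEquality using (_≡_)
open Coefficients using (part-a; part-b; part-c)

proposition6p6 : (k : ℕ) → 1 ≤ k →
    ((j : ℕ) → .{{_ : NonZero j}} → (m : ℕ) →
        Wcoeff (k + k + j) k m
          ≡ ((+ ((k + k + j) C (k ∸ 1))) / j) * narCoeff (j ∸ 1) (k + j ∸ 1) m)
    × ((m : ℕ) → Wcoeff (k + k) k m ≡ partBcoeff k m)
    × ((j : ℕ) → .{{_ : NonZero j}} → j ≤ k → (m : ℕ) →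
        Wcoeff (k + k ∸ j) k m
          ≡ ((+ ((k + k ∸ j) C (k ∸ 1))) / j) * narCoeff (j ∸ 1) (k ∸ 1) m)
proposition6p6 (suc K) _ = part-a K , part-b K , part-c K
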